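{- Let $G$ be a connected $[4,2]$-graph of order $n\ge 8$. Then $e(G)\ge \lfloor (n-1)^2/4\rfloor+1$, with equality if and only if $G$ is isomorphic to $B_n$.
   Context: All graphs are finite and simple. $e(G)$ denotes the number of edges of $G$. For a positive integer $s$ and a nonnegative integer $t$, a graph $G$ of order at least $s$ is called an $[s,t]$-graph if every induced subgraph of $G$ on $s$ vertices has at least $t$ edges. $B_n$ (the barbell graph) is the graph obtained from the vertex-disjoint union of complete graphs $K_{\lfloor n/2\rfloor}$ and $K_{\lceil n/2\rceil}$ by adding one edge joining the two cliques. -}

module Defs where

open import Data.Nat using (ℕ; zero; suc; _+_; _*_; _∸_; _≤_; _<ᵇ_; _≡ᵇ_)
open import Data.Nat.DivMod using (_/_)
open import Data.Bool using (Bool; true; false; _∧_; _∨_; not; if_then_else_)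
open import Data.Fin using (Fin; toℕ)
open import Data.Fin.Subset using (Subset; ∣_∣)
open import Data.Vec using (lookup)
open import Data.List using (List; map; allFin)
open import Data.Nat.ListAction using (sum)
open import Data.Product using (_×_; Σ)
open import Function.Bundles using (_⤖_; Bijection)
open import Relation.Binary.PropositionalEquality using (_≡_)

record Graph (n : ℕ) : Set where
  field
    adj    : Fin n → Fin n → Bool
    sym    : ∀ i j → adj i j ≡ adj j i
    irrefl : ∀ i → adj i i ≡ false
open Graph public

Σv : {n : ℕ} → (Fin n → ℕ) → ℕ
Σv {n} f = sum (map f (allFin n))

edgesWithin : {n : ℕ} → Graph n → (Fin n → Bool) → ℕ
edgesWithin G inS =
  Σv (λ i → Σv (λ j →
    if (toℕ i <ᵇ toℕ j) ∧ inS i ∧ inS j ∧ adj G i j then 1 else 0))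

e : {n : ℕ} → Graph n → ℕ
e G = edgesWithin G (λ _ → true)

inducedEdges : {n : ℕ} → Graph n → Subset n → ℕ
inducedEdges G S = edgesWithin G (λ i → lookup S i)

IsSTGraph : (s t : ℕ) → {n : ℕ} → Graph n → Set
IsSTGraph s t {n} G = s ≤ n × (∀ (S : Subset n) → ∣ S ∣ ≡ s → t ≤ inducedEdges G S)

data Reachable {n : ℕ} (G : Graph n) : Fin n → Fin n → Set where
  here : ∀ {u} → Reachable G u u
  step : ∀ {u v w} → adj G u v ≡ true → Reachable G v w → Reachable G u w

Connected : {n : ℕ} → Graph n → Set
Connected {n} G = ∀ (u v : Fin n) → Reachable G u v

-- Barbell graph B_n on Fin n: vertices 0..k-1 (k = ⌊n/2⌋) form one clique,
-- k..n-1 form the other (of size ⌈n/2⌉), plus the edge {k-1, k}.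
barbellAdj : (n : ℕ) → Fin n → Fin n → Bool
barbellAdj n i j =
  not (a ≡ᵇ b) ∧ (((a <ᵇ k) ≡ᵇB (b <ᵇ k)) ∨ ((a ≡ᵇ k ∸ 1) ∧ (b ≡ᵇ k)) ∨ ((a ≡ᵇ k) ∧ (b ≡ᵇ k ∸ 1)))
  where
    a = toℕ i
    b = toℕ j
    k = n / 2
    _≡ᵇB_ : Bool → Bool → Bool
    true ≡ᵇB y = y
    false ≡ᵇB y = not y

IsoToBarbell : {n : ℕ} → Graph n → Set
IsoToBarbell {n} G =
  Σ (Fin n ⤖ Fin n) λ f →
    ∀ i j → adj G (Bijection.to f i) (Bijection.to f j) ≡ barbellAdj n i j

-- Write H for the complement of G, so that e(G) + e(H) = ⌊n²/4⌋ + ⌊(n-1)²/4⌋: the theorem says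
-- that e(H) ≤ ⌊n²/4⌋ - 1, with equality exactly for the complement of B_n.
--
-- Every four vertices span at most four edges of H, so H is diamond-free: no two triangles of H
-- share an edge. Hence a vertex outside a triangle sees at most one of its vertices, and removing
-- triangles (and then edges, as in Mantel's theorem) shows that a diamond-free graph on k ≠ 3
-- vertices has at most ⌊k²/4⌋ edges.
--
-- For n ≥ 8 this sharpens to: e(H) ≤ ⌊n²/4⌋ - 2 unless H is bipartite. If H has a triangle this
-- follows by removing it. Otherwise let u have maximum degree Δ, which we may assume is at least 3;
-- its neighbourhood is independent, and counting the degrees of the set R of non-neighbours of u
-- shows that an edge inside R forces 2e(H) + Δ ≤ 2|R|Δ ≤ 2⌊n²/4⌋. Without such an edge H is
-- bipartite.
--
-- If H is bipartite with sides A and B, then G consists of two cliques joined by the c ≥ 1 edges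
-- that connectivity requires, and e(H) = |A||B| - c ≤ ⌊n²/4⌋ - 1. Equality forces c = 1 and
-- |A||B| = ⌊n²/4⌋; listing A with its bridge vertex last, followed by B with its bridge vertex
-- first, then lays G out as B_n.

module Submission where

open import Defs renaming (sym to adj-sym; irrefl to adj-irrefl)

open import Data.Bool.Base using (Bool; true; false; not; _∧_; _∨_; if_then_else_)
open import Data.Bool.Properties using (T-≡; ∧-zeroʳ; ∨-identityʳ; ∧-comm; not-injective) renaming (_≟_ to _≟ᵇ_)
open import Data.Empty using (⊥; ⊥-elim)
open import Data.Fin.Base using (Fin; zero; suc; toℕ; fromℕ<; punchOut)
open import Data.Fin.Properties using (_≟_; toℕ-injective; toℕ-fromℕ<; toℕ<n; any?; pigeonhole; punchOut-injective)
  renaming (<⇒≢ to <⇒≢ᶠ)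
open import Data.Fin.Subset using (∣_∣)
open import Data.List.Base using (List; []; _∷_; map)
import Data.List.Base as List
open import Data.List.Relation.Unary.All using (All; []; _∷_)
open import Data.List.Relation.Unary.Unique.Propositional using (Unique; []; _∷_)
open import Data.Nat.Base
open import Data.Nat.Divisibility using (divides)
open import Data.Nat.DivMod using (_/_; /-congˡ; +-distrib-/-∣ʳ; m*n/n≡m; m/n≡1+[m∸n]/n; m/n≤m)
open import Data.Nat.ListAction using () renaming (sum to sumˡ)
open import Data.Nat.Properties hiding (_≟_)
open import Data.Nat.Properties using () renaming (_≟_ to _≟ℕ_)
open import Data.Nat.Tactic.RingSolver using (solve-∀)
open import Algebra.Properties.Semiring.Sum +-*-semiring
  using (sum; sum-syntax; ∑-distrib-+; ∑-comm; ∑-permute; sum-cong-≗; sum-replicate-zero; *-distribʳ-sum; sum-remove)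
open import Data.Product using (Σ; _×_; _,_; proj₁; proj₂; ∃; ∃₂; swap)
open import Data.Sum using (_⊎_; inj₁; inj₂)
import Data.Vec.Base as Vec
open import Data.Vec.Properties using (lookup∘tabulate)
open import Function.Base using (_∘_; id)
open import Function.Bundles using (Equivalence; _⤖_; mk⤖; Bijection; _⇔_; mk⇔)
open import Function.Properties.Bijection using (⤖⇒↔)
open import Relation.Binary.Definitions using (tri<; tri≈; tri>)
open import Relation.Binary.PropositionalEquality
open import Relation.Nullary using (¬_; Dec; yes; no; does; contradiction)
open import Relation.Nullary.Decidable using (_×-dec_)

private variable n : ℕ

-- Quarter squares

⌊_²/4⌋ : ℕ → ℕ
⌊ 0 ²/4⌋ = 0
⌊ 1 ²/4⌋ = 0
⌊ suc (suc n) ²/4⌋ = ⌊ n ²/4⌋ + suc n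

⌊²/4⌋-suc : ∀ n → ⌊ suc n ²/4⌋ ≡ ⌊ n ²/4⌋ + ⌈ n /2⌉
⌊²/4⌋-suc 0 = refl
⌊²/4⌋-suc 1 = refl
⌊²/4⌋-suc (suc (suc n)) = begin
  ⌊ suc n ²/4⌋ + suc (suc n)       ≡⟨ cong (_+ suc (suc n)) (⌊²/4⌋-suc n) ⟩
  ⌊ n ²/4⌋ + ⌈ n /2⌉ + suc (suc n) ≡⟨ shuffle ⌊ n ²/4⌋ ⌈ n /2⌉ n ⟩
  ⌊ n ²/4⌋ + suc n + suc ⌈ n /2⌉   ∎
  where
  open ≡-Reasoning
  shuffle : ∀ q c n → q + c + suc (suc n) ≡ q + suc n + suc c
  shuffle = solve-∀

⌊²/4⌋-suc-≤ : ∀ n → ⌊ suc n ²/4⌋ ≤ ⌊ n ²/4⌋ + n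
⌊²/4⌋-suc-≤ n = begin
  ⌊ suc n ²/4⌋       ≡⟨ ⌊²/4⌋-suc n ⟩
  ⌊ n ²/4⌋ + ⌈ n /2⌉ ≤⟨ +-monoʳ-≤ ⌊ n ²/4⌋ (⌈n/2⌉≤n n) ⟩
  ⌊ n ²/4⌋ + n       ∎
  where open ≤-Reasoning

⌊n²/4⌋≡⌊n/2⌋*⌈n/2⌉ : ∀ n → ⌊ n ²/4⌋ ≡ ⌊ n /2⌋ * ⌈ n /2⌉
⌊n²/4⌋≡⌊n/2⌋*⌈n/2⌉ 0 = refl
⌊n²/4⌋≡⌊n/2⌋*⌈n/2⌉ 1 = refl
⌊n²/4⌋≡⌊n/2⌋*⌈n/2⌉ (suc (suc n)) = begin
  ⌊ n ²/4⌋ + suc n                            ≡⟨ cong₂ (λ q m → q + suc m) (⌊n²/4⌋≡⌊n/2⌋*⌈n/2⌉ n) (sym (⌊n/2⌋+⌈n/2⌉≡n n)) ⟩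
  ⌊ n /2⌋ * ⌈ n /2⌉ + suc (⌊ n /2⌋ + ⌈ n /2⌉) ≡⟨ expand ⌊ n /2⌋ ⌈ n /2⌉ ⟩
  suc ⌊ n /2⌋ * suc ⌈ n /2⌉                   ∎
  where
  open ≡-Reasoning
  expand : ∀ a b → a * b + suc (a + b) ≡ suc a * suc b
  expand = solve-∀

n²≡n+2⌊n²/4⌋+2⌊[n-1]²/4⌋ : ∀ n → n * n ≡ n + 2 * ⌊ n ²/4⌋ + 2 * ⌊ (n ∸ 1) ²/4⌋
n²≡n+2⌊n²/4⌋+2⌊[n-1]²/4⌋ 0 = refl
n²≡n+2⌊n²/4⌋+2⌊[n-1]²/4⌋ 1 = refl
n²≡n+2⌊n²/4⌋+2⌊[n-1]²/4⌋ (suc (suc n)) = begin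
  suc (suc n) * suc (suc n)                               ≡⟨ expand n ⟩
  suc n * suc n + 2 * n + 3                               ≡⟨ cong (λ s → s + 2 * n + 3) (n²≡n+2⌊n²/4⌋+2⌊[n-1]²/4⌋ (suc n)) ⟩
  suc n + 2 * ⌊ suc n ²/4⌋ + 2 * ⌊ n ²/4⌋ + 2 * n + 3     ≡⟨ regroup n ⌊ suc n ²/4⌋ ⌊ n ²/4⌋ ⟩
  suc (suc n) + 2 * (⌊ n ²/4⌋ + suc n) + 2 * ⌊ suc n ²/4⌋ ∎
  where
  open ≡-Reasoning
  expand : ∀ n → suc (suc n) * suc (suc n) ≡ suc n * suc n + 2 * n + 3
  expand = solve-∀
  regroup : ∀ n a b → suc n + 2 * a + 2 * b + 2 * n + 3 ≡ suc (suc n) + 2 * (b + suc n) + 2 * a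
  regroup = solve-∀

n*n/4≡⌊n²/4⌋ : ∀ n → n * n / 4 ≡ ⌊ n ²/4⌋
n*n/4≡⌊n²/4⌋ 0 = refl
n*n/4≡⌊n²/4⌋ 1 = refl
n*n/4≡⌊n²/4⌋ (suc (suc n)) = begin
  suc (suc n) * suc (suc n) / 4 ≡⟨ /-congˡ (expand n) ⟩
  (n * n + suc n * 4) / 4       ≡⟨ +-distrib-/-∣ʳ (n * n) (divides (suc n) refl) ⟩
  n * n / 4 + suc n * 4 / 4     ≡⟨ cong₂ _+_ (n*n/4≡⌊n²/4⌋ n) (m*n/n≡m (suc n) 4) ⟩
  ⌊ n ²/4⌋ + suc n              ∎
  where
  open ≡-Reasoning
  expand : ∀ n → suc (suc n) * suc (suc n) ≡ n * n + suc n * 4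
  expand = solve-∀

n/2≡⌊n/2⌋ : ∀ n → n / 2 ≡ ⌊ n /2⌋
n/2≡⌊n/2⌋ 0 = refl
n/2≡⌊n/2⌋ 1 = refl
n/2≡⌊n/2⌋ (suc (suc n)) = trans (m/n≡1+[m∸n]/n {suc (suc n)} (s≤s (s≤s z≤n))) (cong suc (n/2≡⌊n/2⌋ n))

*≤⌊+²/4⌋ : ∀ a b → a * b ≤ ⌊ (a + b) ²/4⌋
*≤⌊+²/4⌋ zero b = z≤n
*≤⌊+²/4⌋ (suc a) zero = ≤-trans (≤-reflexive (*-zeroʳ (suc a))) z≤n
*≤⌊+²/4⌋ (suc a) (suc b) = begin
  suc a * suc b                ≡⟨ expand a b ⟩
  a * b + suc (a + b)          ≤⟨ +-monoˡ-≤ (suc (a + b)) (*≤⌊+²/4⌋ a b) ⟩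
  ⌊ (a + b) ²/4⌋ + suc (a + b) ≡⟨ cong ⌊_²/4⌋ (cong suc (sym (+-suc a b))) ⟩
  ⌊ (suc a + suc b) ²/4⌋       ∎
  where
  open ≤-Reasoning
  expand : ∀ a b → suc a * suc b ≡ a * b + suc (a + b)
  expand = solve-∀

*≡⌊²/4⌋⇒≡n/2 : ∀ {a b n} → a + b ≡ n → a ≤ b → a * b ≡ ⌊ n ²/4⌋ → a ≡ n / 2
*≡⌊²/4⌋⇒≡n/2 {a} {b} refl a≤b a*b≡ = trans (smaller-half (b ∸ a) (m+[n∸m]≡n a≤b) a*b≡) (sym (n/2≡⌊n/2⌋ (a + b)))
  where
  smaller-half : ∀ d → a + d ≡ b → a * b ≡ ⌊ (a + b) ²/4⌋ → a ≡ ⌊ (a + b) /2⌋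
  smaller-half 0 refl _ = trans (n≡⌊n+n/2⌋ a) (cong ⌊_/2⌋ (cong (a +_) (sym (+-identityʳ a))))
  smaller-half 1 refl _ = trans (n≡⌈n+n/2⌉ a) (cong ⌊_/2⌋ (sym (trans (cong (a +_) (+-comm a 1)) (+-suc a a))))
  -- Otherwise moving one unit from b to a would make the product exceed ⌊(a + b)²/4⌋.
  smaller-half (suc (suc d)) refl a*b≡ = contradiction a*b≡ (<⇒≢ (begin-strict
    a * (a + suc (suc d))           <⟨ n<1+n _ ⟩
    suc (a * (a + suc (suc d)))     ≤⟨ m≤m+n _ d ⟩
    suc (a * (a + suc (suc d))) + d ≡⟨ shift a d ⟩
    suc a * (suc a + d)             ≤⟨ *≤⌊+²/4⌋ (suc a) (suc a + d) ⟩
    ⌊ (suc a + (suc a + d)) ²/4⌋    ≡⟨ cong ⌊_²/4⌋ (regroup a d) ⟩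
    ⌊ (a + (a + suc (suc d))) ²/4⌋  ∎))
    where
    open ≤-Reasoning
    shift : ∀ a d → suc (a * (a + suc (suc d))) + d ≡ suc a * (suc a + d)
    shift = solve-∀
    regroup : ∀ a d → suc a + (suc a + d) ≡ a + (a + suc (suc d))
    regroup = solve-∀

2a+3≤2b⇒2a+4≤2b : ∀ a b → 2 * a + 3 ≤ 2 * b → 2 * a + 4 ≤ 2 * b
2a+3≤2b⇒2a+4≤2b a b 2a+3≤2b = begin
  2 * a + 4   ≡⟨ *-distribˡ-+ 2 a 2 ⟨
  2 * (a + 2) ≤⟨ *-monoʳ-≤ 2 (≤-trans (≤-reflexive (+-comm a 2)) a+1<b) ⟩
  2 * b       ∎
  where
  open ≤-Reasoning
  a+1<b : suc a < b
  a+1<b = *-cancelˡ-< 2 (suc a) b (≤-trans (≤-reflexive (shift a)) 2a+3≤2b)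
    where
    shift : ∀ a → suc (2 * suc a) ≡ 2 * a + 3
    shift = solve-∀

𝟙 : Bool → ℕ
𝟙 b = if b then 1 else 0

_==_ : Fin n → Fin n → Bool
i == j = does (i ≟ j)

==-refl : (i : Fin n) → (i == i) ≡ true
==-refl i with i ≟ i
... | yes _   = refl
... | no  i≢i = contradiction refl i≢i

==-sym : (i j : Fin n) → (i == j) ≡ (j == i)
==-sym i j with i ≟ j | j ≟ i
... | yes _   | yes _   = refl
... | no  _   | no  _   = refl
... | yes i≡j | no  j≢i = contradiction (sym i≡j) j≢i
... | no  i≢j | yes j≡i = contradiction (sym j≡i) i≢j

<⇒<ᵇ≡true : ∀ {m n} → m < n → (m <ᵇ n) ≡ true
<⇒<ᵇ≡true m<n = Equivalence.to T-≡ (<⇒<ᵇ m<n)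

<ᵇ≡true⇒< : ∀ {m n} → (m <ᵇ n) ≡ true → m < n
<ᵇ≡true⇒< {m} {n} m<ᵇn = <ᵇ⇒< m n (Equivalence.from T-≡ m<ᵇn)

≥⇒<ᵇ≡false : ∀ {m n} → n ≤ m → (m <ᵇ n) ≡ false
≥⇒<ᵇ≡false {m} {n} n≤m with m <ᵇ n in m<ᵇn
... | false = refl
... | true  = contradiction (<ᵇ≡true⇒< m<ᵇn) (≤⇒≯ n≤m)

<ᵇ≡false⇒≥ : ∀ {m n} → (m <ᵇ n) ≡ false → n ≤ m
<ᵇ≡false⇒≥ m≮ᵇn = ≮⇒≥ (λ m<n → contradiction (trans (sym m≮ᵇn) (<⇒<ᵇ≡true m<n)) λ ())

≡ᵇ-refl : ∀ m → (m ≡ᵇ m) ≡ true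
≡ᵇ-refl m = Equivalence.to T-≡ (≡⇒≡ᵇ m m refl)

≢⇒≡ᵇ≡false : ∀ {m n} → m ≢ n → (m ≡ᵇ n) ≡ false
≢⇒≡ᵇ≡false {m} {n} m≢n with m ≡ᵇ n in eq
... | false = refl
... | true  = contradiction (≡ᵇ⇒≡ m n (Equivalence.from T-≡ eq)) m≢n

not≡true⇒≡false : {b : Bool} → not b ≡ true → b ≡ false
not≡true⇒≡false {false} _ = refl

not≡false⇒≡true : {b : Bool} → not b ≡ false → b ≡ true
not≡false⇒≡true {true} _ = refl

𝟙-pos : {b : Bool} → 0 < 𝟙 b → b ≡ true
𝟙-pos {true} _ = refl

if-pos : {b : Bool} {x : ℕ} → 0 < (if b then x else 0) → b ≡ true × 0 < x
if-pos {true} 0<x = refl , 0<x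

𝟙≤0⇒≡false : {b : Bool} → 𝟙 b ≤ 0 → b ≡ false
𝟙≤0⇒≡false {false} _ = refl

𝟙+𝟙≤1 : {x y : Bool} → (x ≡ true → y ≡ true → ⊥) → 𝟙 x + (𝟙 y + 0) ≤ 1
𝟙+𝟙≤1 {true}  {true}  excl = ⊥-elim (excl refl refl)
𝟙+𝟙≤1 {true}  {false} excl = ≤-refl
𝟙+𝟙≤1 {false} {true}  excl = ≤-refl
𝟙+𝟙≤1 {false} {false} excl = z≤n

𝟙+𝟙+𝟙≤1 : {x y z : Bool} → (x ≡ true → y ≡ true → ⊥) → (x ≡ true → z ≡ true → ⊥) → (y ≡ true → z ≡ true → ⊥) →
           𝟙 x + (𝟙 y + (𝟙 z + 0)) ≤ 1
𝟙+𝟙+𝟙≤1 {true}  {true}  {_}     xy xz yz = ⊥-elim (xy refl refl)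
𝟙+𝟙+𝟙≤1 {true}  {false} {true}  xy xz yz = ⊥-elim (xz refl refl)
𝟙+𝟙+𝟙≤1 {true}  {false} {false} xy xz yz = ≤-refl
𝟙+𝟙+𝟙≤1 {false} {y}     {z}     xy xz yz = 𝟙+𝟙≤1 yz

∑-const : ∀ n c → ∑[ i < n ] c ≡ n * c
∑-const zero    c = refl
∑-const (suc n) c = cong (c +_) (∑-const n c)

∑-mono-≤ : {f g : Fin n → ℕ} → (∀ i → f i ≤ g i) → sum f ≤ sum g
∑-mono-≤ {zero}  f≤g = z≤n
∑-mono-≤ {suc n} f≤g = +-mono-≤ (f≤g zero) (∑-mono-≤ (f≤g ∘ suc))

∑-pos : (f : Fin n → ℕ) → 0 < sum f → ∃ λ i → 0 < f i
∑-pos {suc n} f 0<∑ with f zero in eq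
... | suc _ = zero , subst (0 <_) (sym eq) z<s
... | zero with ∑-pos (f ∘ suc) 0<∑
...   | i , 0<fi = suc i , 0<fi

≤-∑ : (f : Fin n → ℕ) (a : Fin n) → f a ≤ sum f
≤-∑ {suc n} f a = ≤-trans (m≤m+n (f a) _) (≤-reflexive (sym (sum-remove {i = a} f)))

∑-point : (f : Fin n → ℕ) (a : Fin n) → ∑[ i < n ] (if i == a then f i else 0) ≡ f a
∑-point {suc n} f zero    = trans (cong (f zero +_) (sum-replicate-zero n)) (+-identityʳ (f zero))
∑-point {suc n} f (suc a) = ∑-point (f ∘ suc) a

∑-if : ∀ b (g : Fin n → ℕ) → (if b then sum g else 0) ≡ ∑[ j < n ] (if b then g j else 0)
∑-if {n} true  g = refl
∑-if {n} false g = sym (sum-replicate-zero n)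

∑-𝟙-toℕ≡ᵇ≤1 : (c : ℕ) → ∑[ i < n ] 𝟙 (toℕ i ≡ᵇ c) ≤ 1
∑-𝟙-toℕ≡ᵇ≤1 {zero}  c       = z≤n
∑-𝟙-toℕ≡ᵇ≤1 {suc n} zero    = ≤-reflexive (cong suc (sum-replicate-zero n))
∑-𝟙-toℕ≡ᵇ≤1 {suc n} (suc c) = ∑-𝟙-toℕ≡ᵇ≤1 {n} c

argmax : (f : Fin n → ℕ) → Fin n → ∃ λ u → ∀ v → f v ≤ f u
argmax {suc zero}    f _ = zero , λ { zero → ≤-refl }
argmax {suc (suc n)} f _ with argmax (f ∘ suc) zero
... | u , u-max with f zero ≤? f (suc u)
...   | yes f0≤fu = suc u , λ { zero → f0≤fu ; (suc v) → u-max v }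
...   | no  f0≰fu = zero  , λ { zero → ≤-refl ; (suc v) → ≤-trans (u-max v) (<⇒≤ (≰⇒> f0≰fu)) }

all : Fin n → Bool
all _ = true

∁ : (Fin n → Bool) → Fin n → Bool
∁ A i = not (A i)

_∖_ : (S T : Fin n → Bool) → Fin n → Bool
(S ∖ T) i = S i ∧ not (T i)

_⊆_ : (S T : Fin n → Bool) → Set
S ⊆ T = ∀ {i} → S i ≡ true → T i ≡ true

⟦_⟧ : List (Fin n) → Fin n → Bool
⟦ [] ⟧     i = false
⟦ u ∷ us ⟧ i = (i == u) ∨ ⟦ us ⟧ i

∑∈ : (Fin n → Bool) → (Fin n → ℕ) → ℕ
∑∈ S f = ∑[ i < _ ] (if S i then f i else 0)

syntax ∑∈ S (λ i → x) = ∑[ i ∈ S ] x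

size : (Fin n → Bool) → ℕ
size S = ∑[ i ∈ S ] 1

module _ (S : Fin n → Bool) where

  ∑∈-cong : {f g : Fin n → ℕ} → (∀ {i} → S i ≡ true → f i ≡ g i) → ∑[ i ∈ S ] f i ≡ ∑[ i ∈ S ] g i
  ∑∈-cong f≡g = sum-cong-≗ pointwise
    where
    pointwise : ∀ i → (if S i then _ else 0) ≡ (if S i then _ else 0)
    pointwise i with S i in Si
    ... | true  = f≡g Si
    ... | false = refl

  ∑∈-mono-≤ : {f g : Fin n → ℕ} → (∀ {i} → S i ≡ true → f i ≤ g i) → ∑[ i ∈ S ] f i ≤ ∑[ i ∈ S ] g i
  ∑∈-mono-≤ f≤g = ∑-mono-≤ pointwise
    where
    pointwise : ∀ i → (if S i then _ else 0) ≤ (if S i then _ else 0)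
    pointwise i with S i in Si
    ... | true  = f≤g Si
    ... | false = z≤n

  ∑∈-+ : (f g : Fin n → ℕ) → ∑[ i ∈ S ] (f i + g i) ≡ ∑[ i ∈ S ] f i + ∑[ i ∈ S ] g i
  ∑∈-+ f g = trans (sum-cong-≗ pointwise) (∑-distrib-+ (λ i → if S i then f i else 0) (λ i → if S i then g i else 0))
    where
    pointwise : ∀ i → (if S i then f i + g i else 0) ≡ (if S i then f i else 0) + (if S i then g i else 0)
    pointwise i with S i
    ... | true  = refl
    ... | false = refl

  ∑∈-const : (c : ℕ) → ∑[ i ∈ S ] c ≡ size S * c
  ∑∈-const c = trans (sum-cong-≗ pointwise) (sym (*-distribʳ-sum c (𝟙 ∘ S)))
    where
    pointwise : ∀ i → (if S i then c else 0) ≡ 𝟙 (S i) * c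
    pointwise i with S i
    ... | true  = sym (+-identityʳ c)
    ... | false = refl

  ∑∈-≤-size* : {f : Fin n → ℕ} (c : ℕ) → (∀ {i} → S i ≡ true → f i ≤ c) → ∑[ i ∈ S ] f i ≤ size S * c
  ∑∈-≤-size* c f≤c = ≤-trans (∑∈-mono-≤ f≤c) (≤-reflexive (∑∈-const c))

  ∑∈-point : (f : Fin n → ℕ) (a : Fin n) → ∑[ i ∈ S ] (if i == a then f i else 0) ≡ (if S a then f a else 0)
  ∑∈-point f a = trans (sum-cong-≗ pointwise) (∑-point (λ i → if S i then f i else 0) a)
    where
    pointwise : ∀ i → (if S i then (if i == a then f i else 0) else 0) ≡ (if i == a then (if S i then f i else 0) else 0)
    pointwise i with S i
    ... | true  = refl
    ... | false with i == a
    ...   | true  = refl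
    ...   | false = refl

  ∑∈-split : {T : Fin n → Bool} (f : Fin n → ℕ) → T ⊆ S → ∑[ i ∈ S ] f i ≡ ∑[ i ∈ S ∖ T ] f i + ∑[ i ∈ T ] f i
  ∑∈-split {T} f T⊆S = trans (sum-cong-≗ pointwise) (∑-distrib-+ (λ i → if (S ∖ T) i then f i else 0) (λ i → if T i then f i else 0))
    where
    pointwise : ∀ i → (if S i then f i else 0) ≡ (if (S ∖ T) i then f i else 0) + (if T i then f i else 0)
    pointwise i with T i in Ti
    ... | true  rewrite T⊆S Ti = refl
    ... | false with S i
    ...   | true  = sym (+-identityʳ (f i))
    ...   | false = refl

∑∈-mono-⊆ : {S T : Fin n → Bool} (f : Fin n → ℕ) → S ⊆ T → ∑[ i ∈ S ] f i ≤ ∑[ i ∈ T ] f i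
∑∈-mono-⊆ {T = T} f S⊆T = ≤-trans (m≤n+m _ _) (≤-reflexive (sym (∑∈-split T f S⊆T)))

∑-partition : (A : Fin n → Bool) (f : Fin n → ℕ) → sum f ≡ ∑[ i ∈ A ] f i + ∑[ i ∈ ∁ A ] f i
∑-partition A f = trans (sum-cong-≗ pointwise) (∑-distrib-+ (λ i → if A i then f i else 0) (λ i → if not (A i) then f i else 0))
  where
  pointwise : ∀ i → f i ≡ (if A i then f i else 0) + (if not (A i) then f i else 0)
  pointwise i with A i
  ... | true  = sym (+-identityʳ (f i))
  ... | false = refl

∑∈-comm : (S T : Fin n → Bool) (F : Fin n → Fin n → ℕ) →
          ∑[ i ∈ S ] ∑[ j ∈ T ] F i j ≡ ∑[ j ∈ T ] ∑[ i ∈ S ] F i j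
∑∈-comm S T F = begin
  ∑[ i ∈ S ] ∑[ j ∈ T ] F i j  ≡⟨ sum-cong-≗ (λ i → ∑-if (S i) (λ j → if T j then F i j else 0)) ⟩
  ∑[ i < _ ] ∑[ j < _ ] H i j  ≡⟨ ∑-comm H ⟩
  ∑[ j < _ ] ∑[ i < _ ] H i j  ≡⟨ sum-cong-≗ pull-out ⟩
  ∑[ j ∈ T ] ∑[ i ∈ S ] F i j  ∎
  where
  open ≡-Reasoning
  H : Fin _ → Fin _ → ℕ
  H i j = if S i then (if T j then F i j else 0) else 0
  if-swap : ∀ s t {x} → (if s then (if t then x else 0) else 0) ≡ (if t then (if s then x else 0) else 0)
  if-swap true  t     = refl
  if-swap false true  = refl
  if-swap false false = refl
  pull-out : ∀ j → ∑[ i < _ ] H i j ≡ (if T j then ∑[ i ∈ S ] F i j else 0)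
  pull-out j = trans (sum-cong-≗ (λ i → if-swap (S i) (T j))) (sym (∑-if (T j) (λ i → if S i then F i j else 0)))

⟦⟧-fresh : {u : Fin n} {us : List (Fin n)} → All (u ≢_) us → ⟦ us ⟧ u ≡ false
⟦⟧-fresh []           = refl
⟦⟧-fresh {u = u} (_∷_ {x = v} u≢v u∉us) with u ≟ v
... | yes u≡v = contradiction u≡v u≢v
... | no  _   = ⟦⟧-fresh u∉us

∑∈⟦⟧ : {us : List (Fin n)} (f : Fin n → ℕ) → Unique us → ∑[ i ∈ ⟦ us ⟧ ] f i ≡ sumˡ (map f us)
∑∈⟦⟧ {n} f [] = sum-replicate-zero n
∑∈⟦⟧ {us = u ∷ us} f (u∉us ∷ unique) = begin
  ∑[ i ∈ ⟦ u ∷ us ⟧ ] f i             ≡⟨ sum-cong-≗ pointwise ⟩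
  sum (λ i → at-u i + in-us i)        ≡⟨ ∑-distrib-+ at-u in-us ⟩
  sum at-u + ∑[ i ∈ ⟦ us ⟧ ] f i      ≡⟨ cong₂ _+_ (∑-point f u) (∑∈⟦⟧ f unique) ⟩
  f u + sumˡ (map f us)               ∎
  where
  open ≡-Reasoning
  at-u in-us : Fin _ → ℕ
  at-u  i = if i == u then f i else 0
  in-us i = if ⟦ us ⟧ i then f i else 0
  pointwise : ∀ i → (if ⟦ u ∷ us ⟧ i then f i else 0) ≡ at-u i + in-us i
  pointwise i with i ≟ u
  ... | yes refl rewrite ⟦⟧-fresh u∉us = sym (+-identityʳ (f i))
  ... | no  _    = refl

∖-⊆ : (S T : Fin n → Bool) → (S ∖ T) ⊆ S
∖-⊆ S T {i} S∖Ti with S i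
... | true = refl

∖-∉ : (S T : Fin n → Bool) {i : Fin n} → (S ∖ T) i ≡ true → T i ≡ false
∖-∉ S T {i} S∖Ti with S i | T i
... | true | false = refl

size-∖ : (S : Fin n → Bool) {T : Fin n → Bool} → T ⊆ S → size S ≡ size (S ∖ T) + size T
size-∖ S = ∑∈-split S (λ _ → 1)

⟦⟧-⊆ : {S : Fin n → Bool} {us : List (Fin n)} → All (λ u → S u ≡ true) us → ⟦ us ⟧ ⊆ S
⟦⟧-⊆ {us = u ∷ us} (Su ∷ Sus) {i} i∈us with i ≟ u
... | yes refl = Su
... | no  _    = ⟦⟧-⊆ Sus i∈us

⟦⟧-∉ : {us : List (Fin n)} {i : Fin n} → ⟦ us ⟧ i ≡ false → All (i ≢_) us
⟦⟧-∉ {us = []}     _ = []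
⟦⟧-∉ {us = u ∷ us} {i} i∉us with i ≟ u
... | yes refl with () ← i∉us
... | no  i≢u  = i≢u ∷ ⟦⟧-∉ i∉us

≤-∑∈ : (S : Fin n → Bool) (f : Fin n → ℕ) {a : Fin n} → S a ≡ true → f a ≤ ∑[ i ∈ S ] f i
≤-∑∈ S f {a} Sa = ≤-trans (≤-reflexive (cong (λ b → if b then f a else 0) (sym Sa))) (≤-∑ (λ i → if S i then f i else 0) a)

∑∈-two : (S : Fin n → Bool) (f : Fin n → ℕ) {a b : Fin n} → S a ≡ true → S b ≡ true → a ≢ b → f a + f b ≤ ∑[ i ∈ S ] f i
∑∈-two S f {a} {b} Sa Sb a≢b = begin
  f a + f b                   ≡⟨ cong (f a +_) (+-identityʳ (f b)) ⟨
  f a + (f b + 0)             ≡⟨ ∑∈⟦⟧ f ((a≢b ∷ []) ∷ [] ∷ []) ⟨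
  ∑[ i ∈ ⟦ a ∷ b ∷ [] ⟧ ] f i ≤⟨ ∑∈-mono-⊆ f (⟦⟧-⊆ {S = S} (Sa ∷ Sb ∷ [])) ⟩
  ∑[ i ∈ S ] f i              ∎
  where open ≤-Reasoning

∑∈-zero : (S : Fin n → Bool) {f : Fin n → ℕ} → (∀ {i} → S i ≡ true → f i ≡ 0) → ∑[ i ∈ S ] f i ≡ 0
∑∈-zero S f≡0 = trans (∑∈-cong S f≡0) (trans (∑∈-const S 0) (*-zeroʳ (size S)))

size-all : size (all {n}) ≡ n
size-all {n} = trans (∑-const n 1) (*-identityʳ n)

size-partition : (A : Fin n → Bool) → size A + size (∁ A) ≡ n
size-partition A = trans (sym (∑-partition A (λ _ → 1))) size-all

size-mono : {S T : Fin n → Bool} → S ⊆ T → size S ≤ size T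
size-mono = ∑∈-mono-⊆ (λ _ → 1)

size-mono-< : {S T : Fin n → Bool} {a : Fin n} → S ⊆ T → T a ≡ true → S a ≡ false → size S < size T
size-mono-< {S = S} {T} {a} S⊆T Ta Sa = begin-strict
  size S                <⟨ m<n+m (size S) (≤-trans (≤-reflexive (sym (cong 𝟙 T∖Sa))) (≤-∑ (𝟙 ∘ (T ∖ S)) a)) ⟩
  size (T ∖ S) + size S ≡⟨ size-∖ T S⊆T ⟨
  size T                ∎
  where
  open ≤-Reasoning
  T∖Sa : (T ∖ S) a ≡ true
  T∖Sa rewrite Ta | Sa = refl

size-<ᵇ : ∀ {n} k → k ≤ n → size (λ (i : Fin n) → toℕ i <ᵇ k) ≡ k
size-<ᵇ {n}     zero    _         = sum-replicate-zero n
size-<ᵇ {suc n} (suc k) (s≤s k≤n) = cong suc (size-<ᵇ k k≤n)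

-- Degrees and the complement

adj⇒≢ : (G : Graph n) {i j : Fin n} → adj G i j ≡ true → i ≢ j
adj⇒≢ G {i} Gij refl with () ← trans (sym Gij) (adj-irrefl G i)

deg : Graph n → (Fin n → Bool) → Fin n → ℕ
deg G S i = ∑[ j ∈ S ] 𝟙 (adj G i j)

degreeSum : Graph n → (Fin n → Bool) → ℕ
degreeSum G S = ∑[ i ∈ S ] deg G S i

adj⇒1≤deg : (G : Graph n) (T : Fin n → Bool) {i j : Fin n} → T j ≡ true → adj G i j ≡ true → 1 ≤ deg G T i
adj⇒1≤deg G T {i} Tj ij = subst (_≤ deg G T i) (cong 𝟙 ij) (≤-∑∈ T (λ w → 𝟙 (adj G i w)) Tj)

complement : Graph n → Graph n
complement G = record
  { adj    = λ i j → not (adj G i j) ∧ not (i == j)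
  ; sym    = λ i j → cong₂ (λ a b → not a ∧ not b) (adj-sym G i j) (==-sym i j)
  ; irrefl = λ i → trans (cong (λ b → not (adj G i i) ∧ not b) (==-refl i)) (∧-zeroʳ _)
  }

complement-adj⇒¬adj : (G : Graph n) {i j : Fin n} → adj (complement G) i j ≡ true → adj G i j ≡ false
complement-adj⇒¬adj G {i} {j} Gᶜij with adj G i j
... | false = refl
... | true  with () ← Gᶜij

complement-¬adj⇒adj : (G : Graph n) {i j : Fin n} → i ≢ j → adj (complement G) i j ≡ false → adj G i j ≡ true
complement-¬adj⇒adj G {i} {j} i≢j Gᶜij with adj G i j | i ≟ j
... | true  | _        = refl
... | false | yes i≡j  = contradiction i≡j i≢j
... | false | no  _    with () ← Gᶜij

Σv≡∑ : (f : Fin n → ℕ) → Σv f ≡ sum f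
Σv≡∑ {n} f = sum-map-tabulate id
  where
  sum-map-tabulate : ∀ {m} (g : Fin m → Fin n) → sumˡ (map f (List.tabulate g)) ≡ ∑[ i < m ] f (g i)
  sum-map-tabulate {zero}  g = refl
  sum-map-tabulate {suc m} g = cong (f (g zero) +_) (sum-map-tabulate (g ∘ suc))

𝟙-split-<ᵇ : (P : Fin n → Fin n → Bool) → (∀ i → P i i ≡ false) → ∀ i j →
             𝟙 (P i j) ≡ 𝟙 ((toℕ i <ᵇ toℕ j) ∧ P i j) + 𝟙 ((toℕ j <ᵇ toℕ i) ∧ P i j)
𝟙-split-<ᵇ P P-irrefl i j with <-cmp (toℕ i) (toℕ j)
... | tri< i<j _ _ rewrite <⇒<ᵇ≡true i<j | ≥⇒<ᵇ≡false (<⇒≤ i<j) = sym (+-identityʳ _)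
... | tri> _ _ j<i rewrite <⇒<ᵇ≡true j<i | ≥⇒<ᵇ≡false (<⇒≤ j<i) = refl
... | tri≈ _ i≡j _ rewrite toℕ-injective i≡j | P-irrefl j | ∧-zeroʳ (toℕ j <ᵇ toℕ j) = refl

degreeSum≡2*edgesWithin : (G : Graph n) (S : Fin n → Bool) → degreeSum G S ≡ 2 * edgesWithin G S
degreeSum≡2*edgesWithin {n} G S = begin
  degreeSum G S                                       ≡⟨ sum-cong-≗ as-double-sum ⟩
  ∑[ i < n ] ∑[ j < n ] 𝟙 (P i j)                     ≡⟨ sum-cong-≗ (λ i → sum-cong-≗ (𝟙-split-<ᵇ P P-irrefl i)) ⟩
  ∑[ i < n ] ∑[ j < n ] (forward i j + backward i j)  ≡⟨ sum-cong-≗ (λ i → ∑-distrib-+ (forward i) (backward i)) ⟩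
  ∑[ i < n ] (sum (forward i) + sum (backward i))     ≡⟨ ∑-distrib-+ (sum ∘ forward) (sum ∘ backward) ⟩
  E + ∑[ i < n ] ∑[ j < n ] backward i j              ≡⟨ cong (E +_) (sum-cong-≗ (λ i → sum-cong-≗ (backward≡forward i))) ⟩
  E + ∑[ i < n ] ∑[ j < n ] forward j i               ≡⟨ cong (E +_) (∑-comm (λ i j → forward j i)) ⟩
  E + E                                               ≡⟨ cong (E +_) (+-identityʳ E) ⟨
  2 * E                                               ≡⟨ cong (2 *_) edgesWithin≡E ⟨
  2 * edgesWithin G S                                 ∎
  where
  open ≡-Reasoning
  P : Fin n → Fin n → Bool
  P i j = S i ∧ S j ∧ adj G i j
  P-irrefl : ∀ i → P i i ≡ false
  P-irrefl i rewrite adj-irrefl G i with S i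
  ... | true  = refl
  ... | false = refl
  P-sym : ∀ i j → P i j ≡ P j i
  P-sym i j rewrite adj-sym G i j with S i | S j
  ... | true  | true  = refl
  ... | true  | false = refl
  ... | false | true  = refl
  ... | false | false = refl
  forward backward : Fin n → Fin n → ℕ
  forward  i j = 𝟙 ((toℕ i <ᵇ toℕ j) ∧ P i j)
  backward i j = 𝟙 ((toℕ j <ᵇ toℕ i) ∧ P i j)
  E : ℕ
  E = ∑[ i < n ] ∑[ j < n ] forward i j
  as-conjunction : ∀ i j → (if S i then (if S j then 𝟙 (adj G i j) else 0) else 0) ≡ 𝟙 (P i j)
  as-conjunction i j with S i | S j
  ... | true  | true  = refl
  ... | true  | false = refl
  ... | false | _     = refl
  as-double-sum : ∀ i → (if S i then deg G S i else 0) ≡ ∑[ j < n ] 𝟙 (P i j)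
  as-double-sum i = trans (∑-if (S i) (λ j → if S j then 𝟙 (adj G i j) else 0)) (sum-cong-≗ (as-conjunction i))
  backward≡forward : ∀ i j → backward i j ≡ forward j i
  backward≡forward i j = cong (λ b → 𝟙 ((toℕ j <ᵇ toℕ i) ∧ b)) (P-sym i j)
  edgesWithin≡E : edgesWithin G S ≡ E
  edgesWithin≡E = trans (Σv≡∑ (λ i → Σv (forward i))) (sum-cong-≗ (λ i → Σv≡∑ (forward i)))

module _ (G : Graph n) where

  ∑deg-swap : (S T : Fin n → Bool) → ∑[ i ∈ S ] deg G T i ≡ ∑[ i ∈ T ] deg G S i
  ∑deg-swap S T = trans (∑∈-comm S T (λ i j → 𝟙 (adj G i j)))
                        (∑∈-cong T (λ {j} _ → ∑∈-cong S (λ {i} _ → cong 𝟙 (adj-sym G i j))))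

  degreeSum-∖ : {S T : Fin n → Bool} → T ⊆ S →
                degreeSum G S ≡ degreeSum G (S ∖ T) + 2 * ∑[ i ∈ S ∖ T ] deg G T i + degreeSum G T
  degreeSum-∖ {S} {T} T⊆S = begin
    ∑[ i ∈ S ] deg G S i                                           ≡⟨ ∑∈-cong S (λ {i} _ → ∑∈-split S (λ j → 𝟙 (adj G i j)) T⊆S) ⟩
    ∑[ i ∈ S ] (deg G S′ i + deg G T i)                            ≡⟨ ∑∈-+ S (deg G S′) (deg G T) ⟩
    ∑[ i ∈ S ] deg G S′ i + ∑[ i ∈ S ] deg G T i                   ≡⟨ cong₂ _+_ (∑∈-split S (deg G S′) T⊆S) (∑∈-split S (deg G T) T⊆S) ⟩
    (degreeSum G S′ + ∑[ i ∈ T ] deg G S′ i) + (X + degreeSum G T) ≡⟨ cong (λ Y → degreeSum G S′ + Y + (X + degreeSum G T)) (∑deg-swap T S′) ⟩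
    (degreeSum G S′ + X) + (X + degreeSum G T)                     ≡⟨ regroup (degreeSum G S′) X (degreeSum G T) ⟩
    degreeSum G S′ + 2 * X + degreeSum G T                         ∎
    where
    open ≡-Reasoning
    S′ : Fin n → Bool
    S′ = S ∖ T
    X : ℕ
    X = ∑[ i ∈ S′ ] deg G T i
    regroup : ∀ a x b → (a + x) + (x + b) ≡ a + 2 * x + b
    regroup = solve-∀

  deg<size : {S : Fin n → Bool} {i : Fin n} → S i ≡ true → deg G S i < size S
  deg<size {S} {i} Si = begin-strict
    deg G S i                                              <⟨ m<m+n _ z<s ⟩
    deg G S i + 1                                          ≡⟨ cong (deg G S i +_) (sym (trans (∑∈-point S (λ _ → 1) i) (cong 𝟙 Si))) ⟩
    deg G S i + ∑[ j ∈ S ] (if j == i then 1 else 0)       ≡⟨ sym (∑∈-+ S (λ j → 𝟙 (adj G i j)) (λ j → if j == i then 1 else 0)) ⟩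
    ∑[ j ∈ S ] (𝟙 (adj G i j) + (if j == i then 1 else 0)) ≤⟨ ∑∈-mono-≤ S (λ {j} _ → at-most-one j) ⟩
    size S                                                 ∎
    where
    open ≤-Reasoning
    at-most-one : ∀ j → 𝟙 (adj G i j) + (if j == i then 1 else 0) ≤ 1
    at-most-one j with j ≟ i
    ... | yes refl rewrite adj-irrefl G j = ≤-refl
    ... | no  _    with adj G i j
    ...   | true  = ≤-refl
    ...   | false = z≤n

  degreeSum+size≤size² : (S : Fin n → Bool) → degreeSum G S + size S ≤ size S * size S
  degreeSum+size≤size² S = begin
    degreeSum G S + size S     ≡⟨ sym (∑∈-+ S (deg G S) (λ _ → 1)) ⟩
    ∑[ i ∈ S ] (deg G S i + 1) ≤⟨ ∑∈-≤-size* S (size S) (λ Si → ≤-trans (≤-reflexive (+-comm _ 1)) (deg<size Si)) ⟩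
    size S * size S            ∎
    where open ≤-Reasoning

  degreeSum-removeSparse : {S T : Fin n → Bool} → T ⊆ S → (∀ {i} → (S ∖ T) i ≡ true → deg G T i ≤ 1) →
    degreeSum G S + size T ≤ degreeSum G (S ∖ T) + 2 * size (S ∖ T) + size T * size T
  degreeSum-removeSparse {S} {T} T⊆S sparse = begin
    degreeSum G S + size T                                   ≡⟨ cong (_+ size T) (degreeSum-∖ T⊆S) ⟩
    degreeSum G (S ∖ T) + 2 * X + degreeSum G T + size T     ≡⟨ +-assoc _ (degreeSum G T) (size T) ⟩
    degreeSum G (S ∖ T) + 2 * X + (degreeSum G T + size T)   ≤⟨ +-mono-≤ (+-monoʳ-≤ (degreeSum G (S ∖ T)) (*-monoʳ-≤ 2 X≤)) (degreeSum+size≤size² T) ⟩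
    degreeSum G (S ∖ T) + 2 * size (S ∖ T) + size T * size T ∎
    where
    open ≤-Reasoning
    X : ℕ
    X = ∑[ i ∈ S ∖ T ] deg G T i
    X≤ : X ≤ size (S ∖ T)
    X≤ = ≤-trans (∑∈-≤-size* (S ∖ T) 1 sparse) (≤-reflexive (*-identityʳ _))

  deg+deg-complement : (S : Fin n → Bool) (i : Fin n) → deg G S i + deg (complement G) S i + 𝟙 (S i) ≡ size S
  deg+deg-complement S i = begin
    deg G S i + deg (complement G) S i + 𝟙 (S i)
      ≡⟨ cong₂ _+_ (sym (∑∈-+ S (λ j → 𝟙 (adj G i j)) (λ j → 𝟙 (adj (complement G) i j)))) (sym (∑∈-point S (λ _ → 1) i)) ⟩
    ∑[ j ∈ S ] (𝟙 (adj G i j) + 𝟙 (adj (complement G) i j)) + ∑[ j ∈ S ] (if j == i then 1 else 0)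
      ≡⟨ sym (∑∈-+ S (λ j → 𝟙 (adj G i j) + 𝟙 (adj (complement G) i j)) (λ j → if j == i then 1 else 0)) ⟩
    ∑[ j ∈ S ] (𝟙 (adj G i j) + 𝟙 (adj (complement G) i j) + (if j == i then 1 else 0))
      ≡⟨ ∑∈-cong S (λ {j} _ → exactly-one j) ⟩
    size S
      ∎
    where
    open ≡-Reasoning
    exactly-one : ∀ j → 𝟙 (adj G i j) + 𝟙 (adj (complement G) i j) + (if j == i then 1 else 0) ≡ 1
    exactly-one j with j ≟ i
    ... | yes refl rewrite adj-irrefl G j | ==-refl j = refl
    ... | no  j≢i rewrite ==-sym i j with j ≟ i
    ...   | yes j≡i = contradiction j≡i j≢i
    ...   | no  _ with adj G i j
    ...     | true  = refl
    ...     | false = refl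

  degreeSum+complement+n≡n² : degreeSum G all + degreeSum (complement G) all + n ≡ n * n
  degreeSum+complement+n≡n² = begin
    degreeSum G all + degreeSum (complement G) all + n
      ≡⟨ cong₂ _+_ (sym (∑-distrib-+ (deg G all) (deg (complement G) all))) (sym size-all) ⟩
    ∑[ i < n ] (deg G all i + deg (complement G) all i) + ∑[ i < n ] 1
      ≡⟨ sym (∑-distrib-+ (λ i → deg G all i + deg (complement G) all i) (λ _ → 1)) ⟩
    ∑[ i < n ] (deg G all i + deg (complement G) all i + 1)
      ≡⟨ sum-cong-≗ (deg+deg-complement all) ⟩
    ∑[ i < n ] size (all {n})
      ≡⟨ ∑-const n (size (all {n})) ⟩
    n * size (all {n})
      ≡⟨ cong (n *_) size-all ⟩
    n * n
      ∎
    where open ≡-Reasoning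

degreeSum-⤖ : (G G′ : Graph n) (F : Fin n ⤖ Fin n) → (∀ i j → adj G (Bijection.to F i) (Bijection.to F j) ≡ adj G′ i j) →
              degreeSum G all ≡ degreeSum G′ all
degreeSum-⤖ {n} G G′ F iso = begin
  ∑[ i < n ] ∑[ j < n ] 𝟙 (adj G i j)         ≡⟨ ∑-permute (λ i → ∑[ j < n ] 𝟙 (adj G i j)) (⤖⇒↔ F) ⟩
  ∑[ i < n ] ∑[ j < n ] 𝟙 (adj G (f i) j)     ≡⟨ sum-cong-≗ (λ i → ∑-permute (λ j → 𝟙 (adj G (f i) j)) (⤖⇒↔ F)) ⟩
  ∑[ i < n ] ∑[ j < n ] 𝟙 (adj G (f i) (f j)) ≡⟨ sum-cong-≗ (λ i → sum-cong-≗ (λ j → cong 𝟙 (iso i j))) ⟩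
  ∑[ i < n ] ∑[ j < n ] 𝟙 (adj G′ i j)        ∎
  where
  open ≡-Reasoning
  f : Fin n → Fin n
  f = Bijection.to F

-- Triangles, diamonds and [4,2]-graphs

module _ (G : Graph n) where

  deg-pos : {S : Fin n → Bool} {i : Fin n} → 0 < deg G S i → ∃ λ j → S j ≡ true × adj G i j ≡ true
  deg-pos {S} {i} 0<deg with ∑-pos (λ j → if S j then 𝟙 (adj G i j) else 0) 0<deg
  ... | j , 0<term with if-pos {S j} 0<term
  ...   | Sj , 0<𝟙 = j , Sj , 𝟙-pos 0<𝟙

  degreeSum-pos : {S : Fin n → Bool} → 0 < degreeSum G S → ∃₂ λ i j → S i ≡ true × S j ≡ true × adj G i j ≡ true
  degreeSum-pos {S} 0<ds with ∑-pos (λ i → if S i then deg G S i else 0) 0<ds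
  ... | i , 0<term with if-pos {S i} 0<term
  ...   | Si , 0<deg with deg-pos 0<deg
  ...     | j , Sj , Gij = i , j , Si , Sj , Gij

  degreeSum-cong : {S S′ : Fin n → Bool} → (∀ i → S i ≡ S′ i) → degreeSum G S ≡ degreeSum G S′
  degreeSum-cong {S} {S′} S≗S′ = sum-cong-≗ pointwise
    where
    deg-cong : ∀ i → deg G S i ≡ deg G S′ i
    deg-cong i = sum-cong-≗ (λ j → cong (λ b → if b then 𝟙 (adj G i j) else 0) (S≗S′ j))
    pointwise : ∀ i → (if S i then deg G S i else 0) ≡ (if S′ i then deg G S′ i else 0)
    pointwise i rewrite S≗S′ i | deg-cong i = refl

  TriangleFreeIn : (Fin n → Bool) → Set
  TriangleFreeIn S = ∀ {a b c} → S a ≡ true → S b ≡ true → S c ≡ true →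
                     adj G a b ≡ true → adj G b c ≡ true → adj G a c ≡ true → ⊥

  record Triangle (S : Fin n → Bool) : Set where
    field
      {a b c} : Fin n
      a∈S : S a ≡ true
      b∈S : S b ≡ true
      c∈S : S c ≡ true
      ab  : adj G a b ≡ true
      bc  : adj G b c ≡ true
      ac  : adj G a c ≡ true

    vertices : Fin n → Bool
    vertices = ⟦ a ∷ b ∷ c ∷ [] ⟧

  triangle? : (S : Fin n → Bool) → Triangle S ⊎ TriangleFreeIn S
  triangle? S with any? (λ a → any? (λ b → any? (λ c →
                     S a ≟ᵇ true ×-dec S b ≟ᵇ true ×-dec S c ≟ᵇ true ×-dec
                     adj G a b ≟ᵇ true ×-dec adj G b c ≟ᵇ true ×-dec adj G a c ≟ᵇ true)))
  ... | yes (_ , _ , _ , Sa , Sb , Sc , ab , bc , ac) = inj₁ (record { a∈S = Sa ; b∈S = Sb ; c∈S = Sc ; ab = ab ; bc = bc ; ac = ac })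
  ... | no  no-triangle = inj₂ λ Sa Sb Sc ab bc ac → no-triangle (_ , _ , _ , Sa , Sb , Sc , ab , bc , ac)

  TriangleFreeIn-⊆ : {S S′ : Fin n → Bool} → S′ ⊆ S → TriangleFreeIn S → TriangleFreeIn S′
  TriangleFreeIn-⊆ S′⊆S triangle-free Sa Sb Sc = triangle-free (S′⊆S Sa) (S′⊆S Sb) (S′⊆S Sc)

  DiamondFree : Set
  DiamondFree = ∀ {u v w x} → adj G u v ≡ true → adj G u w ≡ true → adj G v w ≡ true →
                adj G u x ≡ true → adj G v x ≡ true → w ≢ x → ⊥

∣tabulate∣≡size : (S : Fin n → Bool) → ∣ Vec.tabulate S ∣ ≡ size S
∣tabulate∣≡size {zero}  S = refl
∣tabulate∣≡size {suc n} S with S zero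
... | true  = cong suc (∣tabulate∣≡size (S ∘ suc))
... | false = ∣tabulate∣≡size (S ∘ suc)

[4,2]⇒complement-diamondFree : (G : Graph n) → IsSTGraph 4 2 G → DiamondFree (complement G)
[4,2]⇒complement-diamondFree G (_ , dense) {u} {v} {w} {x} uv uw vw ux vx w≢x =
  <⇒≱ (*-cancelˡ-< 2 (inducedEdges G (Vec.tabulate Q)) 2 (s≤s (≤-trans 2*edges≤2 (n≤1+n 2)))) (dense (Vec.tabulate Q) ∣Q∣≡4)
  where
  open ≤-Reasoning
  Q : Fin _ → Bool
  Q = ⟦ u ∷ v ∷ w ∷ x ∷ [] ⟧
  distinct : Unique (u ∷ v ∷ w ∷ x ∷ [])
  distinct = (adj⇒≢ (complement G) uv ∷ adj⇒≢ (complement G) uw ∷ adj⇒≢ (complement G) ux ∷ [])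
           ∷ (adj⇒≢ (complement G) vw ∷ adj⇒≢ (complement G) vx ∷ [])
           ∷ (w≢x ∷ [])
           ∷ [] ∷ []
  ∣Q∣≡4 : ∣ Vec.tabulate Q ∣ ≡ 4
  ∣Q∣≡4 = trans (∣tabulate∣≡size Q) (∑∈⟦⟧ (λ _ → 1) distinct)
  non-adjacent : {i j : Fin _} → adj (complement G) i j ≡ true → adj G i j ≡ false × adj G j i ≡ false
  non-adjacent {i} {j} Gᶜij = complement-adj⇒¬adj G Gᶜij , trans (adj-sym G j i) (complement-adj⇒¬adj G Gᶜij)
  only-wx : degreeSum G Q ≡ 𝟙 (adj G w x) + 𝟙 (adj G x w)
  only-wx = trans expanded (tidy (𝟙 (adj G w x)) (𝟙 (adj G x w)))
    where
    expanded : degreeSum G Q ≡ 𝟙 (adj G w x) + 0 + (𝟙 (adj G x w) + 0 + 0)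
    expanded rewrite ∑∈⟦⟧ (deg G Q) distinct
                   | ∑∈⟦⟧ (λ j → 𝟙 (adj G u j)) distinct | ∑∈⟦⟧ (λ j → 𝟙 (adj G v j)) distinct
                   | ∑∈⟦⟧ (λ j → 𝟙 (adj G w j)) distinct | ∑∈⟦⟧ (λ j → 𝟙 (adj G x j)) distinct
                   | adj-irrefl G u | adj-irrefl G v | adj-irrefl G w | adj-irrefl G x
                   | proj₁ (non-adjacent uv) | proj₂ (non-adjacent uv) | proj₁ (non-adjacent uw) | proj₂ (non-adjacent uw)
                   | proj₁ (non-adjacent vw) | proj₂ (non-adjacent vw) | proj₁ (non-adjacent ux) | proj₂ (non-adjacent ux)
                   | proj₁ (non-adjacent vx) | proj₂ (non-adjacent vx) = refl
    tidy : ∀ a b → a + 0 + (b + 0 + 0) ≡ a + b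
    tidy = solve-∀
  2*edges≤2 : 2 * inducedEdges G (Vec.tabulate Q) ≤ 2
  2*edges≤2 = begin
    2 * inducedEdges G (Vec.tabulate Q)       ≡⟨ sym (degreeSum≡2*edgesWithin G (Vec.lookup (Vec.tabulate Q))) ⟩
    degreeSum G (Vec.lookup (Vec.tabulate Q)) ≡⟨ degreeSum-cong G (lookup∘tabulate Q) ⟩
    degreeSum G Q                             ≡⟨ only-wx ⟩
    𝟙 (adj G w x) + 𝟙 (adj G x w)             ≤⟨ +-mono-≤ (𝟙≤1 (adj G w x)) (𝟙≤1 (adj G x w)) ⟩
    2                                         ∎
    where
    𝟙≤1 : ∀ b → 𝟙 b ≤ 1
    𝟙≤1 true  = ≤-refl
    𝟙≤1 false = z≤n

-- Extremal bounds

module _ (G : Graph n) where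

  degreeSum+k≤k² : {S : Fin n → Bool} {k : ℕ} → size S ≡ k → degreeSum G S + k ≤ k * k
  degreeSum+k≤k² {S} refl = degreeSum+size≤size² G S

  mantel : (S : Fin n → Bool) → TriangleFreeIn G S → degreeSum G S ≤ 2 * ⌊ size S ²/4⌋
  mantel S = mantel′ (size S) S refl
    where
    mantel′ : ∀ k S → size S ≡ k → TriangleFreeIn G S → degreeSum G S ≤ 2 * ⌊ k ²/4⌋
    mantel′ 0 S ∣S∣ _ = m+n≤o⇒m≤o _ (degreeSum+k≤k² ∣S∣)
    mantel′ 1 S ∣S∣ _ = +-cancelʳ-≤ 1 _ 0 (degreeSum+k≤k² ∣S∣)
    mantel′ (suc (suc k)) S ∣S∣ triangle-free with degreeSum G S ≟ℕ 0
    ... | yes ds≡0 = ≤-trans (≤-reflexive ds≡0) z≤n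
    ... | no  ds≢0 with degreeSum-pos G (n≢0⇒n>0 ds≢0)
    ...   | u , v , Su , Sv , uv = +-cancelʳ-≤ 2 _ _ (begin
      degreeSum G S + 2                                        ≡⟨ cong (degreeSum G S +_) (sym ∣T∣) ⟩
      degreeSum G S + size T                                   ≤⟨ degreeSum-removeSparse G T⊆S sparse ⟩
      degreeSum G (S ∖ T) + 2 * size (S ∖ T) + size T * size T ≡⟨ cong₂ (λ a b → degreeSum G (S ∖ T) + 2 * a + b * b) ∣S∖T∣ ∣T∣ ⟩
      degreeSum G (S ∖ T) + 2 * k + 4                          ≤⟨ +-monoˡ-≤ 4 (+-monoˡ-≤ (2 * k) induction) ⟩
      2 * ⌊ k ²/4⌋ + 2 * k + 4                                 ≡⟨ regroup ⌊ k ²/4⌋ k ⟩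
      2 * ⌊ suc (suc k) ²/4⌋ + 2                               ∎)
      where
      open ≤-Reasoning
      T : Fin n → Bool
      T = ⟦ u ∷ v ∷ [] ⟧
      distinct : Unique (u ∷ v ∷ [])
      distinct = (adj⇒≢ G uv ∷ []) ∷ [] ∷ []
      T⊆S : T ⊆ S
      T⊆S = ⟦⟧-⊆ {S = S} (Su ∷ Sv ∷ [])
      ∣T∣ : size T ≡ 2
      ∣T∣ = ∑∈⟦⟧ (λ _ → 1) distinct
      ∣S∖T∣ : size (S ∖ T) ≡ k
      ∣S∖T∣ = +-cancelʳ-≡ 2 _ _ (trans (sym (trans (size-∖ S T⊆S) (cong (size (S ∖ T) +_) ∣T∣))) (trans ∣S∣ (+-comm 2 k)))
      sparse : ∀ {i} → (S ∖ T) i ≡ true → deg G T i ≤ 1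
      sparse {i} S∖Ti = ≤-trans (≤-reflexive (∑∈⟦⟧ (λ j → 𝟙 (adj G i j)) distinct))
        (𝟙+𝟙≤1 (λ iu iv → triangle-free Su Sv (∖-⊆ S T S∖Ti) uv (trans (adj-sym G v i) iv) (trans (adj-sym G u i) iu)))
      induction : degreeSum G (S ∖ T) ≤ 2 * ⌊ k ²/4⌋
      induction = mantel′ k (S ∖ T) ∣S∖T∣ (TriangleFreeIn-⊆ G (∖-⊆ S T) triangle-free)
      regroup : ∀ q k → 2 * q + 2 * k + 4 ≡ 2 * (q + suc k) + 2
      regroup = solve-∀

  module _ {S : Fin n → Bool} (t : Triangle G S) where
    open Triangle t

    private
      distinct : Unique (a ∷ b ∷ c ∷ [])
      distinct = (adj⇒≢ G ab ∷ adj⇒≢ G ac ∷ []) ∷ (adj⇒≢ G bc ∷ []) ∷ [] ∷ []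
      T⊆S : vertices ⊆ S
      T⊆S = ⟦⟧-⊆ {S = S} (a∈S ∷ b∈S ∷ c∈S ∷ [])
      ∣T∣ : size vertices ≡ 3
      ∣T∣ = ∑∈⟦⟧ (λ _ → 1) distinct

    size-removeTriangle : size S ≡ size (S ∖ vertices) + 3
    size-removeTriangle = trans (size-∖ S T⊆S) (cong (size (S ∖ vertices) +_) ∣T∣)

    degreeSum-removeTriangle : DiamondFree G → degreeSum G S + 3 ≤ degreeSum G (S ∖ vertices) + 2 * size (S ∖ vertices) + 9
    degreeSum-removeTriangle diamond-free = begin
      degreeSum G S + 3                                             ≡⟨ cong (degreeSum G S +_) ∣T∣ ⟨
      degreeSum G S + size vertices                                 ≤⟨ degreeSum-removeSparse G T⊆S sparse ⟩
      degreeSum G S′ + 2 * size S′ + size vertices * size vertices  ≡⟨ cong (λ m → degreeSum G S′ + 2 * size S′ + m * m) ∣T∣ ⟩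
      degreeSum G S′ + 2 * size S′ + 9                              ∎
      where
      open ≤-Reasoning
      S′ : Fin n → Bool
      S′ = S ∖ vertices
      adj-sym′ : ∀ {x y} → adj G x y ≡ true → adj G y x ≡ true
      adj-sym′ {x} {y} xy = trans (adj-sym G y x) xy
      sparse : ∀ {i} → (S ∖ vertices) i ≡ true → deg G vertices i ≤ 1
      sparse {i} S∖Ti with ⟦⟧-∉ {us = a ∷ b ∷ c ∷ []} (∖-∉ S vertices S∖Ti)
      ... | i≢a ∷ i≢b ∷ i≢c ∷ [] = ≤-trans (≤-reflexive (∑∈⟦⟧ (λ j → 𝟙 (adj G i j)) distinct)) (𝟙+𝟙+𝟙≤1
        (λ ia ib → diamond-free ab ac bc (adj-sym′ ia) (adj-sym′ ib) (i≢c ∘ sym))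
        (λ ia ic → diamond-free ac ab (adj-sym′ bc) (adj-sym′ ia) (adj-sym′ ic) (i≢b ∘ sym))
        (λ ib ic → diamond-free bc (adj-sym′ ab) (adj-sym′ ac) (adj-sym′ ib) (adj-sym′ ic) (i≢a ∘ sym)))

  diamondFree-degreeSum : DiamondFree G → (S : Fin n → Bool) →
                          degreeSum G S ≤ 2 * ⌊ size S ²/4⌋ + 2 * 𝟙 (size S ≡ᵇ 3)
  diamondFree-degreeSum diamond-free S = bound (size S) S refl
    where
    bound : ∀ k S → size S ≡ k → degreeSum G S ≤ 2 * ⌊ k ²/4⌋ + 2 * 𝟙 (k ≡ᵇ 3)
    bound 0 S ∣S∣ = m+n≤o⇒m≤o _ (degreeSum+k≤k² ∣S∣)
    bound 1 S ∣S∣ = +-cancelʳ-≤ 1 _ 0 (degreeSum+k≤k² ∣S∣)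
    bound 2 S ∣S∣ = +-cancelʳ-≤ 2 _ 2 (degreeSum+k≤k² ∣S∣)
    bound (suc (suc (suc k))) S ∣S∣ with triangle? G S
    ... | inj₂ triangle-free = ≤-trans (subst (λ m → degreeSum G S ≤ 2 * ⌊ m ²/4⌋) ∣S∣ (mantel S triangle-free)) (m≤m+n _ _)
    ... | inj₁ t = +-cancelʳ-≤ 3 _ _ (begin
      degreeSum G S + 3                          ≤⟨ degreeSum-removeTriangle t diamond-free ⟩
      degreeSum G (S ∖ T) + 2 * size (S ∖ T) + 9 ≡⟨ cong (λ a → degreeSum G (S ∖ T) + 2 * a + 9) ∣S∖T∣ ⟩
      degreeSum G (S ∖ T) + 2 * k + 9            ≤⟨ +-monoˡ-≤ 9 (+-monoˡ-≤ (2 * k) (bound k (S ∖ T) ∣S∖T∣)) ⟩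
      2 * ⌊ k ²/4⌋ + 2 * 𝟙 (k ≡ᵇ 3) + 2 * k + 9  ≡⟨ regroup ⌊ k ²/4⌋ (𝟙 (k ≡ᵇ 3)) k ⟩
      2 * (⌊ k ²/4⌋ + 𝟙 (k ≡ᵇ 3) + (3 + k)) + 3  ≤⟨ +-monoˡ-≤ 3 (*-monoʳ-≤ 2 (growth k)) ⟩
      2 * (⌊ 3 + k ²/4⌋ + 𝟙 (k ≡ᵇ 0)) + 3        ≡⟨ cong (_+ 3) (*-distribˡ-+ 2 ⌊ 3 + k ²/4⌋ (𝟙 (k ≡ᵇ 0))) ⟩
      2 * ⌊ 3 + k ²/4⌋ + 2 * 𝟙 (k ≡ᵇ 0) + 3      ∎)
      where
      open ≤-Reasoning
      T : Fin n → Bool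
      T = Triangle.vertices t
      ∣S∖T∣ : size (S ∖ T) ≡ k
      ∣S∖T∣ = +-cancelʳ-≡ 3 _ _ (trans (sym (size-removeTriangle t)) (trans ∣S∣ (+-comm 3 k)))
      regroup : ∀ q b k → 2 * q + 2 * b + 2 * k + 9 ≡ 2 * (q + b + (3 + k)) + 3
      regroup = solve-∀
      growth : ∀ k → ⌊ k ²/4⌋ + 𝟙 (k ≡ᵇ 3) + (3 + k) ≤ ⌊ 3 + k ²/4⌋ + 𝟙 (k ≡ᵇ 0)
      growth 0 = ≤-refl
      growth 1 = ≤-refl
      growth 2 = ≤-refl
      growth 3 = ≤-refl
      growth (suc (suc (suc (suc m)))) = begin
        ⌊ 4 + m ²/4⌋ + 0 + (7 + m)           ≤⟨ +-monoˡ-≤ (7 + m) (+-monoˡ-≤ 0 (⌊²/4⌋-suc-≤ (3 + m))) ⟩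
        ⌊ 3 + m ²/4⌋ + (3 + m) + 0 + (7 + m) ≡⟨ shift ⌊ 3 + m ²/4⌋ m ⟩
        ⌊ 3 + m ²/4⌋ + (4 + m) + (6 + m) + 0 ∎
        where
        shift : ∀ q m → q + (3 + m) + 0 + (7 + m) ≡ q + (4 + m) + (6 + m) + 0
        shift = solve-∀

-- Stability

module _ (G : Graph n) where

  Independent : (Fin n → Bool) → Set
  Independent S = ∀ {i j} → S i ≡ true → S j ≡ true → adj G i j ≡ false

  adj≤∑deg : {S T : Fin n → Bool} {i j : Fin n} → S i ≡ true → T j ≡ true → 𝟙 (adj G i j) ≤ ∑[ v ∈ S ] deg G T v
  adj≤∑deg {S} {T} {i} {j} Si Tj = ≤-trans (≤-∑∈ T (λ j → 𝟙 (adj G i j)) Tj) (≤-∑∈ S (deg G T) Si)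

  degreeSum≡0⇒independent : {S : Fin n → Bool} → degreeSum G S ≡ 0 → Independent S
  degreeSum≡0⇒independent {S} ds≡0 Si Sj = 𝟙≤0⇒≡false (≤-trans (adj≤∑deg {S} {S} Si Sj) (≤-reflexive ds≡0))

  deg-partition : (A : Fin n → Bool) (i : Fin n) → deg G all i ≡ deg G A i + deg G (∁ A) i
  deg-partition A i = ∑-partition A (λ j → 𝟙 (adj G i j))

  degreeSum+degreeSum-∁independent : {N : Fin n → Bool} → Independent N →
    degreeSum G all + degreeSum G (∁ N) ≡ 2 * ∑[ i ∈ ∁ N ] deg G all i
  degreeSum+degreeSum-∁independent {N} independent = begin
    degreeSum G all + degreeSum G R                                 ≡⟨ cong (_+ degreeSum G R) (∑-partition N (deg G all)) ⟩
    ∑[ i ∈ N ] deg G all i + ∑[ i ∈ R ] deg G all i + degreeSum G R ≡⟨ cong (λ s → s + ∑[ i ∈ R ] deg G all i + degreeSum G R) from-N ⟩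
    ∑[ i ∈ R ] deg G N i + ∑[ i ∈ R ] deg G all i + degreeSum G R   ≡⟨ regroup (∑[ i ∈ R ] deg G N i) _ (degreeSum G R) ⟩
    (∑[ i ∈ R ] deg G N i + degreeSum G R) + ∑[ i ∈ R ] deg G all i ≡⟨ cong (_+ ∑[ i ∈ R ] deg G all i) from-R ⟨
    ∑[ i ∈ R ] deg G all i + ∑[ i ∈ R ] deg G all i                 ≡⟨ cong (∑[ i ∈ R ] deg G all i +_) (+-identityʳ _) ⟨
    2 * ∑[ i ∈ R ] deg G all i                                      ∎
    where
    open ≡-Reasoning
    R : Fin n → Bool
    R = ∁ N
    inside-N : ∑[ i ∈ N ] deg G N i ≡ 0
    inside-N = ∑∈-zero N (λ Ni → ∑∈-zero N (λ Nj → cong 𝟙 (independent Ni Nj)))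
    from-N : ∑[ i ∈ N ] deg G all i ≡ ∑[ i ∈ R ] deg G N i
    from-N = begin
      ∑[ i ∈ N ] deg G all i                      ≡⟨ ∑∈-cong N (λ {i} _ → deg-partition N i) ⟩
      ∑[ i ∈ N ] (deg G N i + deg G R i)          ≡⟨ ∑∈-+ N (deg G N) (deg G R) ⟩
      ∑[ i ∈ N ] deg G N i + ∑[ i ∈ N ] deg G R i ≡⟨ cong (_+ ∑[ i ∈ N ] deg G R i) inside-N ⟩
      ∑[ i ∈ N ] deg G R i                        ≡⟨ ∑deg-swap G N R ⟩
      ∑[ i ∈ R ] deg G N i                        ∎
    from-R : ∑[ i ∈ R ] deg G all i ≡ ∑[ i ∈ R ] deg G N i + degreeSum G R
    from-R = trans (∑∈-cong R (λ {i} _ → deg-partition N i)) (∑∈-+ R (deg G N) (deg G R))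
    regroup : ∀ a b c → a + b + c ≡ (a + c) + b
    regroup = solve-∀

record Bipartition (H : Graph n) : Set where
  field
    side          : Fin n → Bool
    bipartite     : ∀ {i j} → side i ≡ side j → adj H i j ≡ false
    {left right}  : Fin n
    left-side     : side left ≡ true
    right-side    : side right ≡ false

module _ (G : Graph n) (triangle-free : TriangleFreeIn G all) {u : Fin n} (u-max : ∀ v → deg G all v ≤ deg G all u) where

  neighbourhood-independent : Independent G (adj G u)
  neighbourhood-independent {i} {j} ui uj with adj G i j in ij
  ... | false = refl
  ... | true  = ⊥-elim (triangle-free refl refl refl ui ij uj)

  degreeSum+Δ≤2∣R∣Δ : {x y : Fin n} → adj G u x ≡ false → adj G u y ≡ false → adj G x y ≡ true →
    degreeSum G all + deg G all u ≤ 2 * (size (∁ (adj G u)) * deg G all u)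
  degreeSum+Δ≤2∣R∣Δ {x} {y} ¬ux ¬uy xy = *-cancelˡ-≤ 2 (+-cancelʳ-≤ (2 * Y) _ _ (begin
    2 * (degreeSum G all + Δ) + 2 * Y       ≡⟨ regroup₁ (degreeSum G all) Δ Y ⟩
    2 * (degreeSum G all + Y) + 2 * Δ       ≡⟨ cong (λ s → 2 * s + 2 * Δ) (degreeSum+degreeSum-∁independent G neighbourhood-independent) ⟩
    2 * (2 * ΣR) + 2 * Δ                    ≡⟨ regroup₂ ΣR Δ ⟩
    2 * ΣR + 2 * (ΣR + Δ)                   ≤⟨ +-mono-≤ (*-monoʳ-≤ 2 ΣR≤) (*-monoʳ-≤ 2 ΣR+Δ≤) ⟩
    2 * (size R * Δ) + 2 * (size R * Δ + Y) ≡⟨ regroup₃ (size R * Δ) Y ⟩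
    2 * (2 * (size R * Δ)) + 2 * Y          ∎))
    where
    open ≤-Reasoning
    Δ : ℕ
    Δ = deg G all u
    N : Fin n → Bool
    N = adj G u
    R : Fin n → Bool
    R = ∁ N
    Y : ℕ
    Y = degreeSum G R
    ΣR : ℕ
    ΣR = ∑[ i ∈ R ] deg G all i
    T : Fin n → Bool
    T = ⟦ x ∷ y ∷ [] ⟧
    distinct : Unique (x ∷ y ∷ [])
    distinct = (adj⇒≢ G xy ∷ []) ∷ [] ∷ []
    T⊆R : T ⊆ R
    T⊆R = ⟦⟧-⊆ {S = R} (cong not ¬ux ∷ cong not ¬uy ∷ [])
    ΣR≤ : ΣR ≤ size R * Δ
    ΣR≤ = ∑∈-≤-size* R Δ (λ {i} _ → u-max i)
    T→N : ∑[ i ∈ T ] deg G N i ≤ Δ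
    T→N = begin
      ∑[ i ∈ T ] ∑[ j ∈ N ] 𝟙 (adj G i j)  ≡⟨ ∑∈-comm T N (λ i j → 𝟙 (adj G i j)) ⟩
      ∑[ j ∈ N ] ∑[ i ∈ T ] 𝟙 (adj G i j)  ≤⟨ ∑∈-mono-≤ N (λ {j} _ → no-common-neighbour j) ⟩
      size N                               ∎
      where
      no-common-neighbour : ∀ j → ∑[ i ∈ T ] 𝟙 (adj G i j) ≤ 1
      no-common-neighbour j = ≤-trans (≤-reflexive (∑∈⟦⟧ (λ i → 𝟙 (adj G i j)) distinct))
                                      (𝟙+𝟙≤1 (λ xj yj → triangle-free refl refl refl xy yj xj))
    T→R : ∑[ i ∈ T ] deg G R i ≤ Y
    T→R = ∑∈-mono-⊆ (deg G R) T⊆R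
    T-degrees : ∑[ i ∈ T ] deg G all i ≤ Δ + Y
    T-degrees = begin
      ∑[ i ∈ T ] deg G all i                       ≡⟨ ∑∈-cong T (λ {i} _ → deg-partition G N i) ⟩
      ∑[ i ∈ T ] (deg G N i + deg G R i)           ≡⟨ ∑∈-+ T (deg G N) (deg G R) ⟩
      ∑[ i ∈ T ] deg G N i + ∑[ i ∈ T ] deg G R i  ≤⟨ +-mono-≤ T→N T→R ⟩
      Δ + Y                                        ∎
    regroup₄ : ∀ r δ y → r * δ + (δ + y) + δ ≡ (r + 2) * δ + y
    regroup₄ = solve-∀
    ΣR+Δ≤ : ΣR + Δ ≤ size R * Δ + Y
    ΣR+Δ≤ = begin
      ΣR + Δ                                                   ≡⟨ cong (_+ Δ) (∑∈-split R (deg G all) T⊆R) ⟩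
      ∑[ i ∈ R ∖ T ] deg G all i + ∑[ i ∈ T ] deg G all i + Δ  ≤⟨ +-monoˡ-≤ Δ (+-mono-≤ (∑∈-≤-size* (R ∖ T) Δ (λ {i} _ → u-max i)) T-degrees) ⟩
      size (R ∖ T) * Δ + (Δ + Y) + Δ                           ≡⟨ regroup₄ (size (R ∖ T)) Δ Y ⟩
      (size (R ∖ T) + 2) * Δ + Y                               ≡⟨ cong (λ s → (size (R ∖ T) + s) * Δ + Y) (∑∈⟦⟧ (λ _ → 1) distinct) ⟨
      (size (R ∖ T) + size T) * Δ + Y                          ≡⟨ cong (λ s → s * Δ + Y) (size-∖ R T⊆R) ⟨
      size R * Δ + Y                                           ∎
    regroup₁ : ∀ d δ y → 2 * (d + δ) + 2 * y ≡ 2 * (d + y) + 2 * δ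
    regroup₁ = solve-∀
    regroup₂ : ∀ s δ → 2 * (2 * s) + 2 * δ ≡ 2 * s + 2 * (s + δ)
    regroup₂ = solve-∀
    regroup₃ : ∀ p y → 2 * p + 2 * (p + y) ≡ 2 * (2 * p) + 2 * y
    regroup₃ = solve-∀

  independentNonNeighbours⇒bipartition : 0 < deg G all u → Independent G (∁ (adj G u)) → Bipartition G
  independentNonNeighbours⇒bipartition 0<Δ R-independent = record
    { side       = adj G u
    ; bipartite  = bipartite
    ; left-side  = proj₂ (proj₂ (deg-pos G {S = all} 0<Δ))
    ; right-side = adj-irrefl G u
    }
    where
    bipartite : ∀ {i j} → adj G u i ≡ adj G u j → adj G i j ≡ false
    bipartite {i} {j} ui≡uj with adj G u i in ui | adj G u j in uj
    ... | true  | true  = neighbourhood-independent ui uj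
    ... | false | false = R-independent (cong not ui) (cong not uj)

  edgeAmongNonNeighbours⇒sparse : 3 ≤ deg G all u → {x y : Fin n} → adj G u x ≡ false → adj G u y ≡ false → adj G x y ≡ true →
    degreeSum G all + 4 ≤ 2 * ⌊ n ²/4⌋
  edgeAmongNonNeighbours⇒sparse 3≤Δ ¬ux ¬uy xy =
    subst (λ d → d + 4 ≤ 2 * ⌊ n ²/4⌋) (sym (degreeSum≡2*edgesWithin G all)) (2a+3≤2b⇒2a+4≤2b (edgesWithin G all) ⌊ n ²/4⌋ (begin
      2 * edgesWithin G all + 3  ≡⟨ cong (_+ 3) (degreeSum≡2*edgesWithin G all) ⟨
      degreeSum G all + 3        ≤⟨ +-monoʳ-≤ (degreeSum G all) 3≤Δ ⟩
      degreeSum G all + Δ        ≤⟨ degreeSum+Δ≤2∣R∣Δ ¬ux ¬uy xy ⟩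
      2 * (size R * Δ)           ≤⟨ *-monoʳ-≤ 2 (*≤⌊+²/4⌋ (size R) Δ) ⟩
      2 * ⌊ size R + Δ ²/4⌋      ≡⟨ cong (λ s → 2 * ⌊ s ²/4⌋) (trans (+-comm (size R) Δ) (size-partition (adj G u))) ⟩
      2 * ⌊ n ²/4⌋               ∎))
    where
    open ≤-Reasoning
    Δ : ℕ
    Δ = deg G all u
    R : Fin n → Bool
    R = ∁ (adj G u)

module _ (H : Graph n) (8≤n : 8 ≤ n) where

  triangle⇒sparse : DiamondFree H → Triangle H all → degreeSum H all + 4 ≤ 2 * ⌊ n ²/4⌋
  triangle⇒sparse diamond-free t = begin
    degreeSum H all + 4                           ≡⟨ +-assoc (degreeSum H all) 3 1 ⟨
    degreeSum H all + 3 + 1                       ≤⟨ +-monoˡ-≤ 1 (degreeSum-removeTriangle H t diamond-free) ⟩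
    degreeSum H S′ + 2 * k + 9 + 1                ≤⟨ +-monoˡ-≤ 1 (+-monoˡ-≤ 9 (+-monoˡ-≤ (2 * k) (diamondFree-degreeSum H diamond-free S′))) ⟩
    2 * ⌊ k ²/4⌋ + 2 * 𝟙 (k ≡ᵇ 3) + 2 * k + 9 + 1 ≤⟨ growth k (+-cancelʳ-≤ 3 5 k (subst (8 ≤_) n≡k+3 8≤n)) ⟩
    2 * ⌊ k + 3 ²/4⌋                              ≡⟨ cong (λ s → 2 * ⌊ s ²/4⌋) n≡k+3 ⟨
    2 * ⌊ n ²/4⌋                                  ∎
    where
    open ≤-Reasoning
    S′ : Fin n → Bool
    S′ = all ∖ Triangle.vertices t
    k : ℕ
    k = size S′
    n≡k+3 : n ≡ k + 3
    n≡k+3 = trans (sym size-all) (size-removeTriangle H t)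
    growth : ∀ k → 5 ≤ k → 2 * ⌊ k ²/4⌋ + 2 * 𝟙 (k ≡ᵇ 3) + 2 * k + 9 + 1 ≤ 2 * ⌊ k + 3 ²/4⌋
    growth k 5≤k with k ∸ 5 | m+[n∸m]≡n 5≤k
    ... | j | refl = begin
      2 * ⌊ 5 + j ²/4⌋ + 0 + 2 * (5 + j) + 9 + 1 ≡⟨ regroup ⌊ 5 + j ²/4⌋ j ⟩
      2 * (⌊ 5 + j ²/4⌋ + 3 + (7 + j))           ≤⟨ *-monoʳ-≤ 2 (+-monoˡ-≤ (7 + j) (+-monoʳ-≤ ⌊ 5 + j ²/4⌋ (s≤s (s≤s (s≤s z≤n))))) ⟩
      2 * (⌊ 5 + j ²/4⌋ + ⌈ 5 + j /2⌉ + (7 + j)) ≡⟨ cong (λ s → 2 * (s + (7 + j))) (⌊²/4⌋-suc (5 + j)) ⟨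
      2 * ⌊ 8 + j ²/4⌋                           ≡⟨ cong (λ s → 2 * ⌊ s ²/4⌋) (+-comm 3 (5 + j)) ⟩
      2 * ⌊ 5 + j + 3 ²/4⌋                       ∎
      where
      regroup : ∀ q j → 2 * q + 0 + 2 * (5 + j) + 9 + 1 ≡ 2 * (q + 3 + (7 + j))
      regroup = solve-∀

  lowDegree⇒sparse : ∀ {Δ} → (∀ v → deg H all v ≤ Δ) → Δ ≤ 2 → degreeSum H all + 4 ≤ 2 * ⌊ n ²/4⌋
  lowDegree⇒sparse {Δ} deg≤Δ Δ≤2 = begin
    degreeSum H all + 4 ≤⟨ +-monoˡ-≤ 4 (∑-mono-≤ (λ v → ≤-trans (deg≤Δ v) Δ≤2)) ⟩
    ∑[ v < n ] 2 + 4    ≡⟨ cong (_+ 4) (trans (∑-const n 2) (*-comm n 2)) ⟩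
    2 * n + 4           ≡⟨ *-distribˡ-+ 2 n 2 ⟨
    2 * (n + 2)         ≤⟨ *-monoʳ-≤ 2 (n+2≤⌊n²/4⌋ 8≤n) ⟩
    2 * ⌊ n ²/4⌋        ∎
    where
    open ≤-Reasoning
    n+2≤⌊n²/4⌋ : ∀ {n} → 8 ≤ n → n + 2 ≤ ⌊ n ²/4⌋
    n+2≤⌊n²/4⌋ {n} 8≤n with n ∸ 8 | m+[n∸m]≡n 8≤n
    ... | j | refl = begin
      8 + j + 2                        ≤⟨ m≤m+n (8 + j + 2) (2 + j) ⟩
      8 + j + 2 + (2 + j)              ≡⟨ regroup j ⟩
      (5 + j) + (7 + j)                ≤⟨ +-monoˡ-≤ (7 + j) (m≤n+m (5 + j) ⌊ 4 + j ²/4⌋) ⟩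
      ⌊ 4 + j ²/4⌋ + (5 + j) + (7 + j) ∎
      where
      regroup : ∀ j → 8 + j + 2 + (2 + j) ≡ (5 + j) + (7 + j)
      regroup = solve-∀

  triangleFree-stability : TriangleFreeIn H all → degreeSum H all + 4 ≤ 2 * ⌊ n ²/4⌋ ⊎ Bipartition H
  triangleFree-stability triangle-free with argmax (deg H all) (fromℕ< (≤-trans (s≤s z≤n) 8≤n))
  ... | u , u-max with deg H all u ≤? 2
  ...   | yes Δ≤2 = inj₁ (lowDegree⇒sparse u-max Δ≤2)
  ...   | no  Δ≰2 with degreeSum H (∁ (adj H u)) ≟ℕ 0
  ...     | yes Y≡0 = inj₂ (independentNonNeighbours⇒bipartition H triangle-free u-max (≤-trans (s≤s z≤n) (≰⇒> Δ≰2))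
                                                                   (degreeSum≡0⇒independent H Y≡0))
  ...     | no  Y≢0 with degreeSum-pos H (n≢0⇒n>0 Y≢0)
  ...       | x , y , Rx , Ry , xy = inj₁ (edgeAmongNonNeighbours⇒sparse H triangle-free u-max (≰⇒> Δ≰2)
                                                                        (not≡true⇒≡false Rx) (not≡true⇒≡false Ry) xy)

  stability : DiamondFree H → degreeSum H all + 4 ≤ 2 * ⌊ n ²/4⌋ ⊎ Bipartition H
  stability diamond-free with triangle? H all
  ... | inj₁ t             = inj₁ (triangle⇒sparse diamond-free t)
  ... | inj₂ triangle-free = triangleFree-stability triangle-free

-- Two cliques

walk-crosses : (G : Graph n) (A : Fin n → Bool) {s t : Fin n} → Reachable G s t → A s ≡ true → A t ≡ false →
               ∃₂ λ i j → A i ≡ true × A j ≡ false × adj G i j ≡ true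
walk-crosses G A here                 As At with () ← trans (sym As) At
walk-crosses G A (step {v = v} sv vt) As At with A v in Av
... | false = _ , v , As , Av , sv
... | true  = walk-crosses G A vt Av At

crossEdges : Graph n → (Fin n → Bool) → ℕ
crossEdges G A = ∑[ i ∈ A ] deg G (∁ A) i

module _ (G : Graph n) where

  deg-complement+deg≡size : (B : Fin n → Bool) {i : Fin n} → B i ≡ false →
    (∀ {j} → B j ≡ false → adj (complement G) i j ≡ false) → deg (complement G) all i + deg G B i ≡ size B
  deg-complement+deg≡size B {i} Bi only-across = begin
    deg Gᶜ all i + deg G B i                 ≡⟨ cong (_+ deg G B i) (∑-partition B (λ j → 𝟙 (adj Gᶜ i j))) ⟩
    deg Gᶜ B i + deg Gᶜ (∁ B) i + deg G B i  ≡⟨ cong (λ s → deg Gᶜ B i + s + deg G B i) outside-B ⟩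
    deg Gᶜ B i + 0 + deg G B i               ≡⟨ regroup (deg Gᶜ B i) (deg G B i) ⟩
    deg G B i + deg Gᶜ B i + 0               ≡⟨ cong (λ b → deg G B i + deg Gᶜ B i + 𝟙 b) Bi ⟨
    deg G B i + deg Gᶜ B i + 𝟙 (B i)         ≡⟨ deg+deg-complement G B i ⟩
    size B                                   ∎
    where
    open ≡-Reasoning
    Gᶜ : Graph n
    Gᶜ = complement G
    outside-B : deg Gᶜ (∁ B) i ≡ 0
    outside-B = ∑∈-zero (∁ B) (λ ∁Bj → cong 𝟙 (only-across (not≡true⇒≡false ∁Bj)))
    regroup : ∀ a b → a + 0 + b ≡ b + a + 0
    regroup = solve-∀

  degreeSum-complement-twoCliques : (A : Fin n → Bool) → (∀ {i j} → A i ≡ A j → adj (complement G) i j ≡ false) →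
    degreeSum (complement G) all + 2 * crossEdges G A ≡ 2 * (size A * size (∁ A))
  degreeSum-complement-twoCliques A same-side = begin
    degreeSum Gᶜ all + 2 * c
      ≡⟨ cong₂ _+_ (∑-partition A (deg Gᶜ all)) (cong (c +_) (+-identityʳ c)) ⟩
    ∑[ i ∈ A ] deg Gᶜ all i + ∑[ i ∈ ∁ A ] deg Gᶜ all i + (c + c)
      ≡⟨ regroup (∑[ i ∈ A ] deg Gᶜ all i) (∑[ i ∈ ∁ A ] deg Gᶜ all i) c ⟩
    (∑[ i ∈ A ] deg Gᶜ all i + c) + (∑[ i ∈ ∁ A ] deg Gᶜ all i + c)
      ≡⟨ cong ((∑[ i ∈ A ] deg Gᶜ all i + c) +_) (cong (∑[ i ∈ ∁ A ] deg Gᶜ all i +_) (∑deg-swap G A (∁ A))) ⟩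
    (∑[ i ∈ A ] deg Gᶜ all i + c) + (∑[ i ∈ ∁ A ] deg Gᶜ all i + ∑[ i ∈ ∁ A ] deg G A i)
      ≡⟨ cong₂ _+_ (sym (∑∈-+ A (deg Gᶜ all) (deg G (∁ A)))) (sym (∑∈-+ (∁ A) (deg Gᶜ all) (deg G A))) ⟩
    ∑[ i ∈ A ] (deg Gᶜ all i + deg G (∁ A) i) + ∑[ i ∈ ∁ A ] (deg Gᶜ all i + deg G A i)
      ≡⟨ cong₂ _+_ (∑∈-cong A in-A) (∑∈-cong (∁ A) in-∁A) ⟩
    ∑[ i ∈ A ] size (∁ A) + ∑[ i ∈ ∁ A ] size A
      ≡⟨ cong₂ _+_ (∑∈-const A (size (∁ A))) (trans (∑∈-const (∁ A) (size A)) (*-comm (size (∁ A)) (size A))) ⟩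
    size A * size (∁ A) + size A * size (∁ A)
      ≡⟨ cong (size A * size (∁ A) +_) (+-identityʳ _) ⟨
    2 * (size A * size (∁ A))
      ∎
    where
    open ≡-Reasoning
    Gᶜ : Graph n
    Gᶜ = complement G
    c : ℕ
    c = crossEdges G A
    in-A : ∀ {i} → A i ≡ true → deg Gᶜ all i + deg G (∁ A) i ≡ size (∁ A)
    in-A Ai = deg-complement+deg≡size (∁ A) (cong not Ai) (λ ∁Aj → same-side (trans Ai (sym (not≡false⇒≡true ∁Aj))))
    in-∁A : ∀ {i} → ∁ A i ≡ true → deg Gᶜ all i + deg G A i ≡ size A
    in-∁A ∁Ai = deg-complement+deg≡size A (not≡true⇒≡false ∁Ai) (λ Aj → same-side (trans (not≡true⇒≡false ∁Ai) (sym Aj)))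
    regroup : ∀ a b c → a + b + (c + c) ≡ (a + c) + (b + c)
    regroup = solve-∀

crossEdges≡1⇒unique : (G : Graph n) (A : Fin n → Bool) → crossEdges G A ≡ 1 →
  ∀ {x y} → A x ≡ true → A y ≡ false → adj G x y ≡ true →
  ∀ {i j} → A i ≡ true → A j ≡ false → adj G i j ≡ true → i ≡ x × j ≡ y
crossEdges≡1⇒unique G A one {x} {y} Ax Ay xy {i} {j} Ai Aj ij with i ≟ x | j ≟ y
... | yes refl | yes refl = refl , refl
... | no  i≢x  | _        = contradiction (begin
  2                             ≤⟨ +-mono-≤ (adj⇒1≤deg G (∁ A) (cong not Ay) xy) (adj⇒1≤deg G (∁ A) (cong not Aj) ij) ⟩
  deg G (∁ A) x + deg G (∁ A) i ≤⟨ ∑∈-two A (deg G (∁ A)) Ax Ai (i≢x ∘ sym) ⟩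
  crossEdges G A                ≡⟨ one ⟩
  1                             ∎) λ { (s≤s ()) }
  where open ≤-Reasoning
... | yes refl | no  j≢y  = contradiction (begin
  2                             ≡⟨ cong₂ (λ a b → 𝟙 a + 𝟙 b) xy ij ⟨
  𝟙 (adj G x y) + 𝟙 (adj G x j) ≤⟨ ∑∈-two (∁ A) (λ w → 𝟙 (adj G x w)) (cong not Ay) (cong not Aj) (j≢y ∘ sym) ⟩
  deg G (∁ A) x                 ≤⟨ ≤-∑∈ A (deg G (∁ A)) Ax ⟩
  crossEdges G A                ≡⟨ one ⟩
  1                             ∎) λ { (s≤s ()) }
  where open ≤-Reasoning

record Dumbbell (G : Graph n) : Set where
  field
    side          : Fin n → Bool
    clique        : ∀ {i j} → i ≢ j → side i ≡ side j → adj G i j ≡ true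
    {x₀ y₀}       : Fin n
    x₀-side       : side x₀ ≡ true
    y₀-side       : side y₀ ≡ false
    bridge        : adj G x₀ y₀ ≡ true
    bridge-unique : ∀ {i j} → side i ≡ true → side j ≡ false → adj G i j ≡ true → i ≡ x₀ × j ≡ y₀

Dumbbell-flip : {G : Graph n} → Dumbbell G → Dumbbell G
Dumbbell-flip {G = G} D = record
  { side          = ∁ side
  ; clique        = λ i≢j same → clique i≢j (not-injective same)
  ; x₀-side       = cong not y₀-side
  ; y₀-side       = cong not x₀-side
  ; bridge        = trans (adj-sym G y₀ x₀) bridge
  ; bridge-unique = λ ∁i ∁j ij → swap (bridge-unique (not≡false⇒≡true ∁j) (not≡true⇒≡false ∁i) (trans (adj-sym G _ _) ij))
  }
  where open Dumbbell D

module _ {G : Graph n} (connected : Connected G) (B : Bipartition (complement G)) where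
  open Bipartition B

  private
    cross : ∃₂ λ i j → side i ≡ true × side j ≡ false × adj G i j ≡ true
    cross = walk-crosses G side (connected left right) left-side right-side

  1≤crossEdges : 1 ≤ crossEdges G side
  1≤crossEdges with cross
  ... | i , j , si , sj , ij = ≤-trans (adj⇒1≤deg G (∁ side) (cong not sj) ij) (≤-∑∈ side (deg G (∁ side)) si)

  complement-degreeSum : degreeSum (complement G) all + 2 * crossEdges G side ≡ 2 * (size side * size (∁ side))
  complement-degreeSum = degreeSum-complement-twoCliques G side bipartite

  complement-degreeSum≤ : degreeSum (complement G) all + 2 * crossEdges G side ≤ 2 * ⌊ n ²/4⌋
  complement-degreeSum≤ = begin
    degreeSum (complement G) all + 2 * crossEdges G side ≡⟨ complement-degreeSum ⟩
    2 * (size side * size (∁ side))                      ≤⟨ *-monoʳ-≤ 2 (*≤⌊+²/4⌋ (size side) (size (∁ side))) ⟩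
    2 * ⌊ size side + size (∁ side) ²/4⌋                 ≡⟨ cong (λ m → 2 * ⌊ m ²/4⌋) (size-partition side) ⟩
    2 * ⌊ n ²/4⌋                                         ∎
    where open ≤-Reasoning

  single-bridge⇒dumbbell : crossEdges G side ≡ 1 → Dumbbell G
  single-bridge⇒dumbbell one with cross
  ... | x , y , sx , sy , xy = record
    { side          = side
    ; clique        = λ i≢j same → complement-¬adj⇒adj G i≢j (bipartite same)
    ; x₀-side       = sx
    ; y₀-side       = sy
    ; bridge        = xy
    ; bridge-unique = crossEdges≡1⇒unique G side one sx sy xy
    }

-- The barbell

module _ {n : ℕ} where

  private
    k : ℕ
    k = n / 2

  barbellAdj-irrefl : (i : Fin n) → barbellAdj n i i ≡ false
  barbellAdj-irrefl i rewrite ≡ᵇ-refl (toℕ i) = refl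

  barbellAdj-sameSide : {i j : Fin n} → i ≢ j → (toℕ i <ᵇ k) ≡ (toℕ j <ᵇ k) → barbellAdj n i j ≡ true
  barbellAdj-sameSide {i} {j} i≢j same rewrite ≢⇒≡ᵇ≡false (i≢j ∘ toℕ-injective) | same with toℕ j <ᵇ k
  ... | true  = refl
  ... | false = refl

  barbellAdj-sym-sameSide : {i j : Fin n} → (toℕ i <ᵇ k) ≡ (toℕ j <ᵇ k) → barbellAdj n i j ≡ barbellAdj n j i
  barbellAdj-sym-sameSide {i} {j} same with i ≟ j
  ... | yes refl = refl
  ... | no  i≢j  = trans (barbellAdj-sameSide i≢j same) (sym (barbellAdj-sameSide (i≢j ∘ sym) (sym same)))

  barbellAdj-cross : {i j : Fin n} → toℕ i < k → k ≤ toℕ j → barbellAdj n i j ≡ ((toℕ i ≡ᵇ k ∸ 1) ∧ (toℕ j ≡ᵇ k))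
  barbellAdj-cross {i} {j} i<k k≤j
    rewrite <⇒<ᵇ≡true i<k | ≥⇒<ᵇ≡false k≤j | ≢⇒≡ᵇ≡false (<⇒≢ (<-≤-trans i<k k≤j)) | ≢⇒≡ᵇ≡false (<⇒≢ i<k) = ∨-identityʳ _

  barbellAdj-cross′ : {i j : Fin n} → k ≤ toℕ i → toℕ j < k → barbellAdj n i j ≡ ((toℕ i ≡ᵇ k) ∧ (toℕ j ≡ᵇ k ∸ 1))
  barbellAdj-cross′ {i} {j} k≤i j<k
    rewrite ≥⇒<ᵇ≡false k≤i | <⇒<ᵇ≡true j<k | ≢⇒≡ᵇ≡false ((<⇒≢ (<-≤-trans j<k k≤i)) ∘ sym)
          | ≢⇒≡ᵇ≡false (<⇒≢ j<k) | ∧-zeroʳ (toℕ i ≡ᵇ k ∸ 1) = refl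

  barbellAdj-sym : (i j : Fin n) → barbellAdj n i j ≡ barbellAdj n j i
  barbellAdj-sym i j with toℕ i <? k | toℕ j <? k
  ... | yes i<k | no  j≮k = trans (barbellAdj-cross i<k (≮⇒≥ j≮k))
                                   (trans (∧-comm (toℕ i ≡ᵇ k ∸ 1) (toℕ j ≡ᵇ k)) (sym (barbellAdj-cross′ (≮⇒≥ j≮k) i<k)))
  ... | no  i≮k | yes j<k = trans (barbellAdj-cross′ (≮⇒≥ i≮k) j<k)
                                   (trans (∧-comm (toℕ i ≡ᵇ k) (toℕ j ≡ᵇ k ∸ 1)) (sym (barbellAdj-cross j<k (≮⇒≥ i≮k))))
  ... | yes i<k | yes j<k = barbellAdj-sym-sameSide (trans (<⇒<ᵇ≡true i<k) (sym (<⇒<ᵇ≡true j<k)))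
  ... | no  i≮k | no  j≮k = barbellAdj-sym-sameSide (trans (≥⇒<ᵇ≡false (≮⇒≥ i≮k)) (sym (≥⇒<ᵇ≡false (≮⇒≥ j≮k))))

barbell : (n : ℕ) → Graph n
barbell n = record { adj = barbellAdj n ; sym = barbellAdj-sym ; irrefl = barbellAdj-irrefl }

module _ {n : ℕ} where

  private
    k : ℕ
    k = n / 2
    L : Fin n → Bool
    L i = toℕ i <ᵇ k

  barbell-complement-bipartite : ∀ {i j} → L i ≡ L j → adj (complement (barbell n)) i j ≡ false
  barbell-complement-bipartite {i} {j} same with i ≟ j
  ... | yes refl = ∧-zeroʳ _
  ... | no  i≢j  rewrite barbellAdj-sameSide i≢j same = refl

  barbell-sides-product : size L * size (∁ L) ≡ ⌊ n ²/4⌋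
  barbell-sides-product = begin
    size L * size (∁ L) ≡⟨ cong₂ _*_ ∣L∣ ∣∁L∣ ⟩
    ⌊ n /2⌋ * ⌈ n /2⌉   ≡⟨ ⌊n²/4⌋≡⌊n/2⌋*⌈n/2⌉ n ⟨
    ⌊ n ²/4⌋            ∎
    where
    open ≡-Reasoning
    ∣L∣ : size L ≡ ⌊ n /2⌋
    ∣L∣ = trans (size-<ᵇ k (m/n≤m n 2)) (n/2≡⌊n/2⌋ n)
    ∣∁L∣ : size (∁ L) ≡ ⌈ n /2⌉
    ∣∁L∣ = +-cancelˡ-≡ ⌊ n /2⌋ _ _ (trans (cong (_+ size (∁ L)) (sym ∣L∣)) (trans (size-partition L) (sym (⌊n/2⌋+⌈n/2⌉≡n n))))

  barbell-crossEdges≤1 : crossEdges (barbell n) L ≤ 1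
  barbell-crossEdges≤1 = begin
    ∑[ i ∈ L ] deg (barbell n) (∁ L) i ≤⟨ ∑∈-mono-≤ L deg≤ ⟩
    ∑[ i ∈ L ] 𝟙 (toℕ i ≡ᵇ k ∸ 1)      ≤⟨ ∑∈-mono-⊆ {S = L} {T = all} (λ i → 𝟙 (toℕ i ≡ᵇ k ∸ 1)) (λ _ → refl) ⟩
    ∑[ i < n ] 𝟙 (toℕ i ≡ᵇ k ∸ 1)      ≤⟨ ∑-𝟙-toℕ≡ᵇ≤1 {n} (k ∸ 1) ⟩
    1                                  ∎
    where
    open ≤-Reasoning
    bridge-only : ∀ p → ∑[ j ∈ ∁ L ] 𝟙 (p ∧ (toℕ j ≡ᵇ k)) ≤ 𝟙 p
    bridge-only true  = ≤-trans (∑∈-mono-⊆ {S = ∁ L} {T = all} (λ j → 𝟙 (toℕ j ≡ᵇ k)) (λ _ → refl)) (∑-𝟙-toℕ≡ᵇ≤1 {n} k)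
    bridge-only false = ≤-reflexive (∑∈-zero (∁ L) (λ _ → refl))
    deg≤ : ∀ {i} → L i ≡ true → deg (barbell n) (∁ L) i ≤ 𝟙 (toℕ i ≡ᵇ k ∸ 1)
    deg≤ {i} Li = begin
      deg (barbell n) (∁ L) i                           ≡⟨ ∑∈-cong (∁ L) (λ {j} ∁Lj → cong 𝟙 (cross ∁Lj)) ⟩
      ∑[ j ∈ ∁ L ] 𝟙 ((toℕ i ≡ᵇ k ∸ 1) ∧ (toℕ j ≡ᵇ k))  ≤⟨ bridge-only (toℕ i ≡ᵇ k ∸ 1) ⟩
      𝟙 (toℕ i ≡ᵇ k ∸ 1)                                ∎
      where
      cross : ∀ {j} → ∁ L j ≡ true → barbellAdj n i j ≡ ((toℕ i ≡ᵇ k ∸ 1) ∧ (toℕ j ≡ᵇ k))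
      cross {j} ∁Lj = barbellAdj-cross {n} {i} {j} (<ᵇ≡true⇒< Li) (<ᵇ≡false⇒≥ (not≡true⇒≡false ∁Lj))

-- Laying out a dumbbell as the barbell

injective⇒surjective : (g : Fin n → Fin n) → (∀ {x y} → g x ≡ g y → x ≡ y) → ∀ y → ∃ λ x → g x ≡ y
injective⇒surjective {suc n} g g-injective y with any? (λ x → g x ≟ y)
... | yes hit  = hit
... | no  miss with pigeonhole (n<1+n n) (λ x → punchOut {i = y} (λ y≡gx → miss (x , sym y≡gx)))
...   | i , j , i<j , same =
  contradiction (g-injective (punchOut-injective (λ y≡gi → miss (i , sym y≡gi)) (λ y≡gj → miss (j , sym y≡gj)) same)) (<⇒≢ᶠ i<j)

inverse-⤖ : (g : Fin n → Fin n) → (∀ {x y} → g x ≡ g y → x ≡ y) → Σ (Fin n ⤖ Fin n) λ F → ∀ y → g (Bijection.to F y) ≡ y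
inverse-⤖ g g-injective = mk⤖ {to = f} (f-injective , f-surjective) , g∘f
  where
  f : Fin _ → Fin _
  f y = proj₁ (injective⇒surjective g g-injective y)
  g∘f : ∀ y → g (f y) ≡ y
  g∘f y = proj₂ (injective⇒surjective g g-injective y)
  f-injective : ∀ {x y} → f x ≡ f y → x ≡ y
  f-injective {x} {y} fx≡fy = trans (sym (g∘f x)) (trans (cong g fx≡fy) (g∘f y))
  f-surjective : ∀ v → ∃ λ y → ∀ {z} → z ≡ y → f z ≡ v
  f-surjective v = g v , λ { refl → g-injective (g∘f (g v)) }

rank : (Fin n → ℕ) → Fin n → ℕ
rank key v = size (λ w → key w <ᵇ key v)

module _ {n : ℕ} (key : Fin n → ℕ) where

  rank-mono-< : {v w : Fin n} → key v < key w → rank key v < rank key w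
  rank-mono-< {v} {w} kv<kw = size-mono-< {S = λ u → key u <ᵇ key v} {T = λ u → key u <ᵇ key w}
    (λ ku<kv → <⇒<ᵇ≡true (<-trans (<ᵇ≡true⇒< ku<kv) kv<kw)) (<⇒<ᵇ≡true kv<kw) (≥⇒<ᵇ≡false (≤-refl {key v}))

  rank-injective : (∀ {v w} → key v ≡ key w → v ≡ w) → ∀ {v w} → rank key v ≡ rank key w → v ≡ w
  rank-injective key-injective {v} {w} same-rank with <-cmp (key v) (key w)
  ... | tri< kv<kw _ _ = contradiction same-rank (<⇒≢ (rank-mono-< kv<kw))
  ... | tri≈ _ kv≡kw _ = key-injective kv≡kw
  ... | tri> _ _ kw<kv = contradiction (sym same-rank) (<⇒≢ (rank-mono-< kw<kv))

  rank<n : (v : Fin n) → rank key v < n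
  rank<n v = subst (rank key v <_) (size-all {n}) (size-mono-< {T = all} {a = v} (λ _ → refl) refl (≥⇒<ᵇ≡false (≤-refl {key v})))

module _ {n : ℕ} (class : Fin n → ℕ) where

  lexKey : Fin n → ℕ
  lexKey v = toℕ v + class v * n

  lexKey-mono : {v w : Fin n} → class v < class w → lexKey v < lexKey w
  lexKey-mono {v} {w} cv<cw = begin-strict
    toℕ v + class v * n <⟨ +-monoˡ-< (class v * n) (toℕ<n v) ⟩
    suc (class v) * n   ≤⟨ *-monoˡ-≤ n cv<cw ⟩
    class w * n         ≤⟨ m≤n+m (class w * n) (toℕ w) ⟩
    toℕ w + class w * n ∎
    where open ≤-Reasoning

  lexKey-injective : {v w : Fin n} → lexKey v ≡ lexKey w → v ≡ w
  lexKey-injective {v} {w} same with <-cmp (class v) (class w)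
  ... | tri< cv<cw _ _ = contradiction same (<⇒≢ (lexKey-mono cv<cw))
  ... | tri> _ _ cw<cv = contradiction (sym same) (<⇒≢ (lexKey-mono cw<cv))
  ... | tri≈ _ cv≡cw _ = toℕ-injective (+-cancelʳ-≡ (class w * n) (toℕ v) (toℕ w) (subst (λ c → toℕ v + c * n ≡ lexKey w) cv≡cw same))

  lexKey-<⇒class-≤ : {v w : Fin n} → lexKey v < lexKey w → class v ≤ class w
  lexKey-<⇒class-≤ kv<kw = ≮⇒≥ (λ cw<cv → <-asym kv<kw (lexKey-mono cw<cv))

module _ {n : ℕ} {key : Fin n → ℕ} (key-injective : ∀ {v w} → key v ≡ key w → v ≡ w) where

  rank-≡ᵇ : (v w : Fin n) → (rank key v ≡ᵇ rank key w) ≡ (v == w)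
  rank-≡ᵇ v w with v ≟ w
  ... | yes refl = ≡ᵇ-refl (rank key v)
  ... | no  v≢w  = ≢⇒≡ᵇ≡false (v≢w ∘ rank-injective key key-injective)

module _ {G : Graph n} (D : Dumbbell G) (balanced : size (Dumbbell.side D) ≡ n / 2) where
  open Dumbbell D

  private
    k : ℕ
    k = n / 2

    -- The side of x₀ comes first with x₀ last, then y₀, then the rest of the other side.
    class : Fin n → ℕ
    class v = if side v then (if v == x₀ then 1 else 0) else (if v == y₀ then 2 else 3)

    key : Fin n → ℕ
    key = lexKey class
    position : Fin n → ℕ
    position = rank key

    class-left : ∀ {v} → side v ≡ true → class v ≤ 1
    class-left {v} sv rewrite sv with v == x₀
    ... | true  = ≤-refl
    ... | false = z≤n

    class-right : ∀ {v} → side v ≡ false → 2 ≤ class v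
    class-right {v} sv rewrite sv with v == y₀
    ... | true  = ≤-refl
    ... | false = s≤s (s≤s z≤n)

    class≤1⇒left : ∀ {v} → class v ≤ 1 → side v ≡ true
    class≤1⇒left {v} cv≤1 with side v | v == y₀
    ... | true  | _     = refl
    ... | false | true  = contradiction cv≤1 λ { (s≤s ()) }
    ... | false | false = contradiction cv≤1 λ { (s≤s ()) }

    class-x₀ : class x₀ ≡ 1
    class-x₀ rewrite x₀-side | ==-refl x₀ = refl

    class-y₀ : class y₀ ≡ 2
    class-y₀ rewrite y₀-side | ==-refl y₀ = refl

    class-left-other : ∀ {v} → side v ≡ true → v ≢ x₀ → class v ≡ 0
    class-left-other {v} sv v≢x₀ rewrite sv with v ≟ x₀
    ... | yes v≡x₀ = contradiction v≡x₀ v≢x₀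
    ... | no  _    = refl

    class≤2⇒left : ∀ {v} → class v ≤ 2 → v ≢ y₀ → side v ≡ true
    class≤2⇒left {v} cv≤2 v≢y₀ with side v in sv
    ... | true  = refl
    ... | false with v ≟ y₀
    ...   | yes v≡y₀ = contradiction v≡y₀ v≢y₀
    ...   | no  _    = contradiction cv≤2 λ { (s≤s (s≤s ())) }

    below : Fin n → Fin n → Bool
    below v w = key w <ᵇ key v

    position-left : ∀ {v} → side v ≡ true → position v < k
    position-left {v} sv = subst (position v <_) balanced
      (size-mono-< {S = below v} {T = side} {a = v}
        (λ kw<kv → class≤1⇒left (≤-trans (lexKey-<⇒class-≤ class (<ᵇ≡true⇒< kw<kv)) (class-left sv)))
        sv (≥⇒<ᵇ≡false (≤-refl {key v})))

    position-right : ∀ {v} → side v ≡ false → k ≤ position v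
    position-right {v} sv = subst (_≤ position v) balanced (size-mono {S = side} {T = below v}
      (λ sw → <⇒<ᵇ≡true (lexKey-mono class (≤-trans (s≤s (class-left sw)) (class-right sv)))))

    position-x₀ : position x₀ ≡ k ∸ 1
    position-x₀ = ≤-antisym (<⇒≤pred (position-left x₀-side)) (begin
      k ∸ 1                    ≡⟨ cong (_∸ 1) (trans (sym balanced) ∣side∣) ⟩
      size (side ∖ X₀) + 1 ∸ 1 ≡⟨ m+n∸n≡m (size (side ∖ X₀)) 1 ⟩
      size (side ∖ X₀)         ≤⟨ size-mono {S = side ∖ X₀} {T = below x₀} others-below ⟩
      position x₀              ∎)
      where
      open ≤-Reasoning
      X₀ : Fin n → Bool
      X₀ = ⟦ x₀ ∷ [] ⟧
      ∣side∣ : size side ≡ size (side ∖ X₀) + 1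
      ∣side∣ = trans (size-∖ side (⟦⟧-⊆ {S = side} {us = x₀ ∷ []} (x₀-side ∷ [])))
                     (cong (size (side ∖ X₀) +_) (∑∈⟦⟧ {us = x₀ ∷ []} (λ _ → 1) ([] ∷ [])))
      others-below : (side ∖ X₀) ⊆ below x₀
      others-below {w} sw∖X₀ with ⟦⟧-∉ {us = x₀ ∷ []} (∖-∉ side X₀ sw∖X₀)
      ... | w≢x₀ ∷ [] = <⇒<ᵇ≡true (lexKey-mono class (subst₂ _<_ (sym (class-left-other (∖-⊆ side X₀ sw∖X₀) w≢x₀)) (sym class-x₀) z<s))

    position-y₀ : position y₀ ≡ k
    position-y₀ = ≤-antisym (subst (position y₀ ≤_) balanced (size-mono {S = below y₀} {T = side} below⇒left)) (position-right y₀-side)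
      where
      below⇒left : below y₀ ⊆ side
      below⇒left {w} kw<ky₀ = class≤2⇒left (≤-trans (lexKey-<⇒class-≤ class kw<ky₀′) (≤-reflexive class-y₀))
                                             (λ { refl → <-irrefl refl kw<ky₀′ })
        where
        kw<ky₀′ : key w < key y₀
        kw<ky₀′ = <ᵇ≡true⇒< kw<ky₀

    position-side : ∀ v → (position v <ᵇ k) ≡ side v
    position-side v = on-side refl
      where
      on-side : ∀ {b} → side v ≡ b → (position v <ᵇ k) ≡ b
      on-side {true}  sv = <⇒<ᵇ≡true (position-left sv)
      on-side {false} sv = ≥⇒<ᵇ≡false (position-right sv)

    vertex : Fin n → Fin n
    vertex v = fromℕ< (rank<n key v)

    toℕ-vertex : ∀ v → toℕ (vertex v) ≡ position v
    toℕ-vertex v = toℕ-fromℕ< (rank<n key v)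

    vertex-injective : ∀ {v w} → vertex v ≡ vertex w → v ≡ w
    vertex-injective {v} {w} same =
      rank-injective key (lexKey-injective class) (trans (sym (toℕ-vertex v)) (trans (cong toℕ same) (toℕ-vertex w)))

    bridge-adj : ∀ {v w} → side v ≡ true → side w ≡ false → adj G v w ≡ ((v == x₀) ∧ (w == y₀))
    bridge-adj {v} {w} sv sw with v ≟ x₀ | w ≟ y₀ | adj G v w in vw
    ... | yes refl | yes refl | _     = trans (sym vw) bridge
    ... | yes refl | no  w≢y₀ | true  = contradiction (proj₂ (bridge-unique sv sw vw)) w≢y₀
    ... | no  v≢x₀ | _        | true  = contradiction (proj₁ (bridge-unique sv sw vw)) v≢x₀
    ... | yes refl | no  _    | false = refl
    ... | no  _    | _        | false = refl

    cross-adj : ∀ {v w} → side v ≡ true → side w ≡ false → adj G v w ≡ barbellAdj n (vertex v) (vertex w)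
    cross-adj {v} {w} sv sw = begin
      adj G v w                                                  ≡⟨ bridge-adj sv sw ⟩
      (v == x₀) ∧ (w == y₀)                                      ≡⟨ cong₂ _∧_ (position-≡ᵇ v x₀) (position-≡ᵇ w y₀) ⟨
      (position v ≡ᵇ position x₀) ∧ (position w ≡ᵇ position y₀)  ≡⟨ cong₂ (λ a b → (position v ≡ᵇ a) ∧ (position w ≡ᵇ b)) position-x₀ position-y₀ ⟩
      (position v ≡ᵇ k ∸ 1) ∧ (position w ≡ᵇ k)                  ≡⟨ cong₂ (λ a b → (a ≡ᵇ k ∸ 1) ∧ (b ≡ᵇ k)) (toℕ-vertex v) (toℕ-vertex w) ⟨
      (toℕ (vertex v) ≡ᵇ k ∸ 1) ∧ (toℕ (vertex w) ≡ᵇ k)          ≡⟨ barbellAdj-cross vertex-v-left vertex-w-right ⟨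
      barbellAdj n (vertex v) (vertex w)                         ∎
      where
      open ≡-Reasoning
      position-≡ᵇ : ∀ a b → (position a ≡ᵇ position b) ≡ (a == b)
      position-≡ᵇ = rank-≡ᵇ (lexKey-injective class)
      vertex-v-left : toℕ (vertex v) < k
      vertex-v-left = subst (_< k) (sym (toℕ-vertex v)) (position-left sv)
      vertex-w-right : k ≤ toℕ (vertex w)
      vertex-w-right = subst (k ≤_) (sym (toℕ-vertex w)) (position-right sw)

    same-side-adj : ∀ {v w} → v ≢ w → side v ≡ side w → adj G v w ≡ barbellAdj n (vertex v) (vertex w)
    same-side-adj {v} {w} v≢w same = trans (clique v≢w same) (sym (barbellAdj-sameSide (v≢w ∘ vertex-injective) (begin
      toℕ (vertex v) <ᵇ k ≡⟨ cong (_<ᵇ k) (toℕ-vertex v) ⟩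
      position v <ᵇ k     ≡⟨ position-side v ⟩
      side v              ≡⟨ same ⟩
      side w              ≡⟨ position-side w ⟨
      position w <ᵇ k     ≡⟨ cong (_<ᵇ k) (toℕ-vertex w) ⟨
      toℕ (vertex w) <ᵇ k ∎)))
      where open ≡-Reasoning

    adj≡barbellAdj : ∀ v w → adj G v w ≡ barbellAdj n (vertex v) (vertex w)
    adj≡barbellAdj v w with v ≟ w
    ... | yes refl = trans (adj-irrefl G v) (sym (barbellAdj-irrefl (vertex v)))
    ... | no  v≢w = by-sides refl refl
      where
      by-sides : ∀ {a b} → side v ≡ a → side w ≡ b → adj G v w ≡ barbellAdj n (vertex v) (vertex w)
      by-sides {true}  {false} sv sw = cross-adj sv sw
      by-sides {false} {true}  sv sw = trans (adj-sym G v w) (trans (cross-adj sw sv) (barbellAdj-sym (vertex w) (vertex v)))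
      by-sides {true}  {true}  sv sw = same-side-adj v≢w (trans sv (sym sw))
      by-sides {false} {false} sv sw = same-side-adj v≢w (trans sv (sym sw))

  balancedDumbbell⇒isoToBarbell : IsoToBarbell G
  balancedDumbbell⇒isoToBarbell = F , iso
    where
    inverse : Σ (Fin n ⤖ Fin n) λ F → ∀ y → vertex (Bijection.to F y) ≡ y
    inverse = inverse-⤖ vertex vertex-injective
    F : Fin n ⤖ Fin n
    F = proj₁ inverse
    iso : ∀ i j → adj G (Bijection.to F i) (Bijection.to F j) ≡ barbellAdj n i j
    iso i j = trans (adj≡barbellAdj (Bijection.to F i) (Bijection.to F j))
                    (cong₂ (barbellAdj n) (proj₂ inverse i) (proj₂ inverse j))

degreeSum+complement≡2⌊n²/4⌋+2⌊[n-1]²/4⌋ : (G : Graph n) →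
  degreeSum G all + degreeSum (complement G) all ≡ 2 * ⌊ n ²/4⌋ + 2 * ⌊ (n ∸ 1) ²/4⌋
degreeSum+complement≡2⌊n²/4⌋+2⌊[n-1]²/4⌋ {n} G = +-cancelʳ-≡ n _ _ (begin
  degreeSum G all + degreeSum (complement G) all + n ≡⟨ degreeSum+complement+n≡n² G ⟩
  n * n                                              ≡⟨ n²≡n+2⌊n²/4⌋+2⌊[n-1]²/4⌋ n ⟩
  n + 2 * ⌊ n ²/4⌋ + 2 * ⌊ (n ∸ 1) ²/4⌋              ≡⟨ regroup n (2 * ⌊ n ²/4⌋) (2 * ⌊ (n ∸ 1) ²/4⌋) ⟩
  2 * ⌊ n ²/4⌋ + 2 * ⌊ (n ∸ 1) ²/4⌋ + n              ∎)
  where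
  open ≡-Reasoning
  regroup : ∀ n a b → n + a + b ≡ a + b + n
  regroup = solve-∀

module _ (G : Graph n) where

  private
    Q : ℕ
    Q = ⌊ n ²/4⌋
    P : ℕ
    P = ⌊ (n ∸ 1) ²/4⌋
    D : ℕ
    D = degreeSum (complement G) all

    count : 2 * e G + D ≡ 2 * Q + 2 * P
    count = trans (cong (_+ D) (sym (degreeSum≡2*edgesWithin G all))) (degreeSum+complement≡2⌊n²/4⌋+2⌊[n-1]²/4⌋ G)

    regroup : ∀ c p d → 2 * (c + p) + d ≡ 2 * p + (d + 2 * c)
    regroup = solve-∀

  edges-≥ : (c : ℕ) → D + 2 * c ≤ 2 * Q → c + P ≤ e G
  edges-≥ c D+2c≤2Q = *-cancelˡ-≤ 2 (+-cancelʳ-≤ D _ _ (begin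
    2 * (c + P) + D     ≡⟨ regroup c P D ⟩
    2 * P + (D + 2 * c) ≤⟨ +-monoʳ-≤ (2 * P) D+2c≤2Q ⟩
    2 * P + 2 * Q       ≡⟨ +-comm (2 * P) (2 * Q) ⟩
    2 * Q + 2 * P       ≡⟨ count ⟨
    2 * e G + D         ∎))
    where open ≤-Reasoning

  edges-≤ : (c : ℕ) → 2 * Q ≤ D + 2 * c → e G ≤ c + P
  edges-≤ c 2Q≤D+2c = *-cancelˡ-≤ 2 (+-cancelʳ-≤ D _ _ (begin
    2 * e G + D         ≡⟨ count ⟩
    2 * Q + 2 * P       ≡⟨ +-comm (2 * Q) (2 * P) ⟩
    2 * P + 2 * Q       ≤⟨ +-monoʳ-≤ (2 * P) 2Q≤D+2c ⟩
    2 * P + (D + 2 * c) ≡⟨ regroup c P D ⟨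
    2 * (c + P) + D     ∎))
    where open ≤-Reasoning

  edges-≡ : (c : ℕ) → e G ≡ c + P → D + 2 * c ≡ 2 * Q
  edges-≡ c e≡c+P = +-cancelˡ-≡ (2 * P) _ _ (begin
    2 * P + (D + 2 * c) ≡⟨ regroup c P D ⟨
    2 * (c + P) + D     ≡⟨ cong (λ m → 2 * m + D) e≡c+P ⟨
    2 * e G + D         ≡⟨ count ⟩
    2 * Q + 2 * P       ≡⟨ +-comm (2 * Q) (2 * P) ⟩
    2 * P + 2 * Q       ∎)
    where open ≡-Reasoning

isoToBarbell⇒edges≤ : (G : Graph n) → IsoToBarbell G → e G ≤ suc ⌊ (n ∸ 1) ²/4⌋
isoToBarbell⇒edges≤ {n} G (F , iso) = begin
  e G                ≡⟨ same-edges ⟩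
  e (barbell n)      ≤⟨ edges-≤ (barbell n) 1 barbell-complement ⟩
  suc ⌊ (n ∸ 1) ²/4⌋ ∎
  where
  open ≤-Reasoning
  L : Fin n → Bool
  L i = toℕ i <ᵇ n / 2
  same-edges : e G ≡ e (barbell n)
  same-edges = *-cancelˡ-≡ (e G) (e (barbell n)) 2 (trans (sym (degreeSum≡2*edgesWithin G all))
                 (trans (degreeSum-⤖ G (barbell n) F iso) (degreeSum≡2*edgesWithin (barbell n) all)))
  barbell-complement : 2 * ⌊ n ²/4⌋ ≤ degreeSum (complement (barbell n)) all + 2 * 1
  barbell-complement = begin
    2 * ⌊ n ²/4⌋
      ≡⟨ cong (2 *_) (barbell-sides-product {n}) ⟨
    2 * (size L * size (∁ L))
      ≡⟨ degreeSum-complement-twoCliques (barbell n) L (barbell-complement-bipartite {n}) ⟨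
    degreeSum (complement (barbell n)) all + 2 * crossEdges (barbell n) L
      ≤⟨ +-monoʳ-≤ _ (*-monoʳ-≤ 2 (barbell-crossEdges≤1 {n})) ⟩
    degreeSum (complement (barbell n)) all + 2 * 1
      ∎

module _ {G : Graph n} (8≤n : 8 ≤ n) (connected : Connected G) (dense : IsSTGraph 4 2 G) where

  private
    P : ℕ
    P = ⌊ (n ∸ 1) ²/4⌋
    structure : degreeSum (complement G) all + 4 ≤ 2 * ⌊ n ²/4⌋ ⊎ Bipartition (complement G)
    structure = stability (complement G) 8≤n ([4,2]⇒complement-diamondFree G dense)

  edges-lowerBound : suc P ≤ e G
  edges-lowerBound with structure
  ... | inj₁ sparse = ≤-trans (n≤1+n _) (edges-≥ G 2 sparse)
  ... | inj₂ B      = ≤-trans (+-monoˡ-≤ P (1≤crossEdges connected B)) (edges-≥ G _ (complement-degreeSum≤ connected B))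

  module _ (B : Bipartition (complement G)) (extremal : e G ≡ suc P) where
    open Bipartition B

    private
      single-bridge : crossEdges G side ≡ 1
      single-bridge = ≤-antisym
        (+-cancelʳ-≤ P _ 1 (subst (crossEdges G side + P ≤_) extremal (edges-≥ G _ (complement-degreeSum≤ connected B))))
        (1≤crossEdges connected B)

      sides≡⌊n²/4⌋ : size side * size (∁ side) ≡ ⌊ n ²/4⌋
      sides≡⌊n²/4⌋ = *-cancelˡ-≡ (size side * size (∁ side)) ⌊ n ²/4⌋ 2 (begin
        2 * (size side * size (∁ side))                      ≡⟨ complement-degreeSum connected B ⟨
        degreeSum (complement G) all + 2 * crossEdges G side ≡⟨ cong (λ c → degreeSum (complement G) all + 2 * c) single-bridge ⟩
        degreeSum (complement G) all + 2 * 1                 ≡⟨ edges-≡ G 1 extremal ⟩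
        2 * ⌊ n ²/4⌋                                         ∎)
        where open ≡-Reasoning

      dumbbell : Dumbbell G
      dumbbell = single-bridge⇒dumbbell connected B single-bridge

      by-sizes : Dec (size side ≤ size (∁ side)) → IsoToBarbell G
      by-sizes (yes ≤∁) = balancedDumbbell⇒isoToBarbell dumbbell
        (*≡⌊²/4⌋⇒≡n/2 (size-partition side) ≤∁ sides≡⌊n²/4⌋)
      by-sizes (no  ≰∁) = balancedDumbbell⇒isoToBarbell (Dumbbell-flip dumbbell)
        (*≡⌊²/4⌋⇒≡n/2 (trans (+-comm (size (∁ side)) (size side)) (size-partition side)) (<⇒≤ (≰⇒> ≰∁))
          (trans (*-comm (size (∁ side)) (size side)) sides≡⌊n²/4⌋))

    bipartition-extremal⇒isoToBarbell : IsoToBarbell G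
    bipartition-extremal⇒isoToBarbell = by-sizes (size side ≤? size (∁ side))

  extremal⇒isoToBarbell : e G ≡ suc P → IsoToBarbell G
  extremal⇒isoToBarbell extremal with structure
  ... | inj₁ sparse = contradiction (subst (2 + P ≤_) extremal (edges-≥ G 2 sparse)) (<-irrefl refl)
  ... | inj₂ B      = bipartition-extremal⇒isoToBarbell B extremal

theorem10 : (n : ℕ) (G : Graph n) → 8 ≤ n → Connected G → IsSTGraph 4 2 G →
    (suc (((n ∸ 1) * (n ∸ 1)) / 4) ≤ e G)
      × ((e G ≡ suc (((n ∸ 1) * (n ∸ 1)) / 4)) ⇔ IsoToBarbell G)
theorem10 n G 8≤n connected dense rewrite n*n/4≡⌊n²/4⌋ (n ∸ 1) =
  lower-bound , mk⇔ (extremal⇒isoToBarbell 8≤n connected dense) (λ iso → ≤-antisym (isoToBarbell⇒edges≤ G iso) lower-bound)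
  where
  lower-bound : suc ⌊ (n ∸ 1) ²/4⌋ ≤ e G
  lower-bound = edges-lowerBound 8≤n connected dense
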